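{- Let $G$ be a finite group and $H$ a normal subgroup such that: (1) $H$ is abelian; (2) $G/H$ is abelian of order $d$, with $G/H\cong\mathbb{Z}/m_1\times\cdots\times\mathbb{Z}/m_s$, $m_1\mid\cdots\mid m_s$, $\prod_i m_i=d$, and fix $t_1,\dots,t_s\in G$ such that $t_iH$ generates the factor $\cong\mathbb{Z}/m_i$ (so $t_i^{m_i}\in H$); (3) $[G,[G,G]]=\{1\}$. Then: (i) each $g\in G$ has a unique decomposition $g=t_1^{a_1}\cdots t_s^{a_s}h$ with $0\le a_i\le m_i-1$, $h\in H$, and $T_{G/H}(g)=\prod_{i=1}^s T_{G/H}(t_i)^{a_i}\cdot T_{G/H}(h)$; (ii) $T_{G/H}(t_i)=t_i^d\,[t_i^{m_i},\alpha_i]$ and $T_{G/H}(h)=h^d\,[h,\alpha]$, where $\alpha_i\in G/H$ is the product of all elements of a subgroup $C_i\subset G/H$ complementary to the cyclic subgroup generated by $t_iH$, and $\alpha\in G/H$ is the product of all elements of $G/H$; here $[t_i^{m_i},\alpha_i]:=[t_i^{m_i},\widehat{\alpha_i}]$ and $[h,\alpha]:=[h,\widehat{\alpha}]$ for arbitrary representatives $\widehat{\alpha_i},\widehat{\alpha}\in G$, and these commutators are independent of the representatives and have order $\le 2$; (iii) $T_{G/H}(g)=g^d\cdot\varphi_{G/H}(g)$, where $\varphi_{G/H}(g)\in Z(G)$ has order $\le 2$. Moreover $[G,G]^d=\{1\}$, i.e. $G^d\subseteq Z(G)$.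
   Context: For a subgroup $H$ of finite index in $G$ with left transversal $\{t_1,\dots,t_n\}$, write $gt_i\in t_{g(i)}H$; the transfer $T_{G/H}:G\to H/[H,H]$ is $T_{G/H}(g)=\prod_{i} t_{g(i)}^{ -1}gt_i\,[H,H]$. When $H$ is abelian, $H/[H,H]=H$. $Z(G)$ is the center of $G$ and $[x,y]$ denotes the commutator. -}

module Defs where

open import Level using (Level; _⊔_; suc)
open import Algebra.Bundles using (Group)
open import Data.Nat as ℕ using (ℕ; zero; NonZero; _%_; _+_)
open import Data.Nat.Divisibility using (_∣_)
import Data.Nat as Nat
open import Data.Fin as Fin using (Fin; toℕ)
open import Data.Product using (Σ; ∃; ∃-syntax; _×_; _,_)
open import Data.Sum using (_⊎_)
open import Relation.Binary.PropositionalEquality using (_≡_; _≢_)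
open import Relation.Unary using (Pred)

private variable c ℓ p q : Level

prodℕ : (n : ℕ) → (Fin n → ℕ) → ℕ
prodℕ zero f = 1
prodℕ (Nat.suc n) f = f Fin.zero Nat.* prodℕ n (λ i → f (Fin.suc i))

module _ (G : Group c ℓ) where
  open Group G

  pow : Carrier → ℕ → Carrier
  pow x zero = ε
  pow x (Nat.suc n) = x ∙ pow x n

  prodFin : (n : ℕ) → (Fin n → Carrier) → Carrier
  prodFin zero f = ε
  prodFin (Nat.suc n) f = f Fin.zero ∙ prodFin n (λ i → f (Fin.suc i))

  comm : Carrier → Carrier → Carrier
  comm x y = ((x ⁻¹ ∙ y ⁻¹) ∙ x) ∙ y

  Central : Carrier → Set (c ⊔ ℓ)
  Central z = ∀ g → (z ∙ g) ≈ (g ∙ z)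

  Finite : Set (c ⊔ ℓ)
  Finite = Σ ℕ λ n → Σ (Fin n → Carrier) λ f → ∀ x → ∃[ i ] (f i ≈ x)

  record IsSubgroup (P : Pred Carrier p) : Set (c ⊔ ℓ ⊔ p) where
    field
      resp  : ∀ {x y} → x ≈ y → P x → P y
      ε∈    : P ε
      ∙∈    : ∀ {x y} → P x → P y → P (x ∙ y)
      ⁻¹∈   : ∀ {x} → P x → P (x ⁻¹)

  record IsNormalSubgroup (P : Pred Carrier p) : Set (c ⊔ ℓ ⊔ p) where
    field
      isSubgroup : IsSubgroup P
      conj∈      : ∀ g {x} → P x → P ((g ⁻¹ ∙ x) ∙ g)

  record Transversal (K : Pred Carrier q) (H : Pred Carrier p) (n : ℕ)
         : Set (c ⊔ ℓ ⊔ p ⊔ q) where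
    field
      rep      : Fin n → Carrier
      rep∈     : ∀ i → K (rep i)
      distinct : ∀ i j → H (rep i ⁻¹ ∙ rep j) → i ≡ j
      covers   : ∀ x → K x → ∃[ i ] H (rep i ⁻¹ ∙ x)

  -- A left transversal of H in G, together with the index map x ↦ i
  -- such that x ∈ t_i H (so g t_i ∈ t_{g(i)} H with g(i) = idx (g ∙ t_i)).
  record LeftTransversal (H : Pred Carrier p) (n : ℕ) : Set (c ⊔ ℓ ⊔ p) where
    field
      t        : Fin n → Carrier
      distinct : ∀ i j → H (t i ⁻¹ ∙ t j) → i ≡ j
      idx      : Carrier → Fin n
      idx-spec : ∀ x → H (t (idx x) ⁻¹ ∙ x)

  -- The transfer T_{G/H}(g) = ∏ᵢ t_{g(i)}⁻¹ g tᵢ  (H abelian, so H/[H,H] = H).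
  transfer : {H : Pred Carrier p} {n : ℕ} → LeftTransversal H n → Carrier → Carrier
  transfer {n = n} T g = prodFin n (λ i → (t (idx (g ∙ t i)) ⁻¹ ∙ g) ∙ t i)
    where open LeftTransversal T

  record Setting (p : Level) : Set (c ⊔ ℓ ⊔ suc p) where
    field
      finite    : Finite
      H         : Pred Carrier p
      H-normal  : IsNormalSubgroup H
      H-abelian : ∀ {x y} → H x → H y → (x ∙ y) ≈ (y ∙ x)
      -- |G/H| = d, witnessed by a left transversal of H in G of size d
      d         : ℕ
      T         : LeftTransversal H d
      s         : ℕ
      m         : Fin s → ℕ
      m-nz      : ∀ i → NonZero (m i)
      m-div     : ∀ i j → i Fin.≤ j → m i ∣ m j
      m-prod    : prodℕ s m ≡ d
      -- the isomorphism, given as a surjective homomorphism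
      -- π : G → ℤ/m₁ × ⋯ × ℤ/mₛ with kernel exactly H
      π         : Carrier → (i : Fin s) → Fin (m i)
      π-resp    : ∀ {x y} → x ≈ y → ∀ i → π x i ≡ π y i
      π-hom     : ∀ x y i → toℕ (π (x ∙ y) i)
                    ≡ _%_ (toℕ (π x i) + toℕ (π y i)) (m i) {{m-nz i}}
      π-ker     : ∀ x → H x → ∀ i → toℕ (π x i) ≡ 0
      π-ker⁻¹   : ∀ x → (∀ i → toℕ (π x i) ≡ 0) → H x
      π-surj    : ∀ (a : (i : Fin s) → Fin (m i)) → ∃[ x ] (∀ i → π x i ≡ a i)
      -- tᵢ H generates the i-th factor ℤ/mᵢ (i.e. π(tᵢ) is the i-th unit vector)
      ts        : Fin s → Carrier
      π-ts      : ∀ i → toℕ (π (ts i) i) ≡ _%_ 1 (m i) {{m-nz i}}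
      π-ts-off  : ∀ i j → j ≢ i → toℕ (π (ts i) j) ≡ 0
      class2    : ∀ x y z → comm z (comm x y) ≈ ε

  module _ {p : Level} (S : Setting p) where
    open Setting S

    Tr : Carrier → Carrier
    Tr = transfer T

    decomp : ((i : Fin s) → Fin (m i)) → Carrier
    decomp a = prodFin s (λ i → pow (ts i) (toℕ (a i)))

    Part-i : Set (c ⊔ ℓ ⊔ p)
    Part-i = ∀ g →
        (∃[ a ] ∃[ h ] (H h × g ≈ (decomp a ∙ h)))
      × (∀ a h a′ h′ → H h → H h′ → g ≈ (decomp a ∙ h) → g ≈ (decomp a′ ∙ h′)
           → (∀ i → a i ≡ a′ i) × h ≈ h′)
      × (∀ a h → H h → g ≈ (decomp a ∙ h)
           → Tr g ≈ (prodFin s (λ i → pow (Tr (ts i)) (toℕ (a i))) ∙ Tr h))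

    -- C is (the preimage in G of) a subgroup of G/H complementary to ⟨tᵢ H⟩
    IsComplement : Fin s → Pred Carrier p → Set (c ⊔ ℓ ⊔ p)
    IsComplement i K =
        IsSubgroup K
      × (∀ {x} → H x → K x)
      × (∀ g n → K g → H ((pow (ts i) n) ⁻¹ ∙ g) → H g)
      × (∀ g → ∃[ k ] ∃[ n ] (K k × H ((k ∙ pow (ts i) n) ⁻¹ ∙ g)))

    Part-ii : Set (c ⊔ ℓ ⊔ suc p)
    Part-ii =
        (∀ i (K : Pred Carrier p) → IsComplement i K →
         ∀ e (R : Transversal K H e) →
         -- αᵢ = product of all elements of K/H; α̂, α̂′ representatives of αᵢ
         let αᵢ = prodFin e (Transversal.rep R) in
         ∀ α̂ α̂′ → H (αᵢ ⁻¹ ∙ α̂) → H (αᵢ ⁻¹ ∙ α̂′) →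
             Tr (ts i) ≈ (pow (ts i) d ∙ comm (pow (ts i) (m i)) α̂)
           × comm (pow (ts i) (m i)) α̂ ≈ comm (pow (ts i) (m i)) α̂′
           × (comm (pow (ts i) (m i)) α̂ ∙ comm (pow (ts i) (m i)) α̂) ≈ ε)
      × (∀ h → H h →
         -- α = product of all elements of G/H; α̂, α̂′ representatives of α
         let α = prodFin d (LeftTransversal.t T) in
         ∀ α̂ α̂′ → H (α ⁻¹ ∙ α̂) → H (α ⁻¹ ∙ α̂′) →
             Tr h ≈ (pow h d ∙ comm h α̂)
           × comm h α̂ ≈ comm h α̂′
           × (comm h α̂ ∙ comm h α̂) ≈ ε)

    Part-iii : Set (c ⊔ ℓ)
    Part-iii = ∀ g → ∃[ φ ] (Tr g ≈ (pow g d ∙ φ) × Central φ × (φ ∙ φ) ≈ ε)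

    Moreover : Set (c ⊔ ℓ)
    Moreover = (∀ x y → pow (comm x y) d ≈ ε) × (∀ g → Central (pow g d))

module Submission where

-- Since G/H is abelian, commutators lie in H, and [G,[G,G]] = 1 makes them central and
-- bilinear. The transfer is a homomorphism into the abelian group H and does not depend on
-- the transversal. For h ∈ H each factor t⁻¹ h t equals h [h, t], so Tr h = h^d [h, α]. For a
-- generator tᵢ we use the transversal {r_j tᵢ^a} built from a transversal r of a complement
-- of ⟨tᵢH⟩: left multiplication by tᵢ cycles a, every factor is [tᵢ, r_j] except the wrapping
-- one, which is tᵢ^{mᵢ} [tᵢ, r_j], whence Tr tᵢ = tᵢ^d [tᵢ^{mᵢ}, αᵢ]. Inversion permutes the
-- cosets, so α² and αᵢ² lie in H and these commutators are involutions. Bilinearity together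
-- with mᵢ ∣ d and mⱼ mₖ ∣ d (j ≠ k) reduces [x, y]^d = 1 to generators, and then
-- (xy)^d = x^d y^d [y, x]^{d(d-1)/2} shows that g ↦ Tr(g) g^{-d} is multiplicative up to a
-- central involution, which gives (iii) from the generators.

open import Defs
open import Level using (Level; _⊔_; Lift; lift)
open import Algebra.Bundles using (Group; CommutativeMonoid)
import Algebra.Properties.CommutativeMonoid.Sum as MonoidSum
open import Data.Nat as ℕ using (ℕ; zero; suc; _+_; _*_; _∸_; _<_; _%_; NonZero; z≤n; s≤s)
import Data.Nat.Properties as ℕ
open import Data.Nat.Divisibility using (_∣_; divides; 1∣_; ∣-trans; m∣m*n; n∣m*n; *-monoʳ-∣)
open import Data.Nat.DivMod using (m<n⇒m%n≡m; %-distribˡ-+; n%n≡0; m%n<n; m%n%n≡m%n)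
open import Data.Nat.Combinatorics using (_C_; nC1≡n; nCk+nC[k+1]≡[n+1]C[k+1])
open import Data.Nat.Tactic.RingSolver using (solve-∀)
open import Data.Fin as Fin using (Fin; toℕ; fromℕ<; combine; remQuot; _↑ˡ_; _↑ʳ_)
import Data.Fin.Properties as Fin
open import Data.Fin.Permutation as Perm using (Permutation; _⟨$⟩ʳ_; permutation)
open import Data.Empty using (⊥-elim)
open import Data.Unit using (⊤; tt)
open import Data.Product using (Σ; ∃-syntax; _×_; _,_; proj₁; proj₂; uncurry)
open import Data.List using (List; lookup; filter; allFin; length)
open import Data.List.Membership.Propositional using (_∈_)
open import Data.List.Membership.Propositional.Properties using (∈-lookup; ∈-filter⁺; ∈-filter⁻; ∈-allFin)
import Data.List.Relation.Unary.All as All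
open import Data.List.Relation.Unary.AllPairs using (_∷_)
import Data.List.Relation.Unary.Any as Any
open import Data.List.Relation.Unary.Any.Properties using (lookup-index)
open import Data.List.Relation.Unary.Unique.Propositional using (Unique)
import Data.List.Relation.Unary.Unique.Propositional.Properties as Unique
open import Function using (_∘_)
open import Relation.Binary using (Rel; IsEquivalence)
open import Relation.Binary.PropositionalEquality as ≡ using (_≡_; _≢_)
open import Relation.Nullary using (Dec; yes; no)
open import Relation.Unary using (Pred)

suc-C2 : ∀ n → suc n C 2 ≡ n + n C 2
suc-C2 n = ≡.trans (≡.sym (nCk+nC[k+1]≡[n+1]C[k+1] n 1)) (≡.cong (_+ n C 2) (nC1≡n n))

C2+C2 : ∀ n → n C 2 + n C 2 ≡ (n ∸ 1) * n
C2+C2 zero          = ≡.refl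
C2+C2 (suc zero)    = ≡.refl
C2+C2 (suc (suc k)) = begin
  suc (suc k) C 2 + suc (suc k) C 2          ≡⟨ ≡.cong₂ _+_ (suc-C2 (suc k)) (suc-C2 (suc k)) ⟩
  (suc k + suc k C 2) + (suc k + suc k C 2)  ≡⟨ interchange (suc k) (suc k C 2) ⟩
  (suc k + suc k) + (suc k C 2 + suc k C 2)  ≡⟨ ≡.cong (suc k + suc k +_) (C2+C2 (suc k)) ⟩
  (suc k + suc k) + k * suc k                ≡⟨ expand k ⟩
  suc k * suc (suc k)                        ∎
  where
  open ≡.≡-Reasoning
  interchange : ∀ a b → (a + b) + (a + b) ≡ (a + a) + (b + b)
  interchange = solve-∀
  expand : ∀ k → (suc k + suc k) + k * suc k ≡ suc k * suc (suc k)
  expand = solve-∀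

lookup-injective : ∀ {a} {A : Set a} {xs : List A} → Unique xs → ∀ i j → lookup xs i ≡ lookup xs j → i ≡ j
lookup-injective (_ ∷ _)     Fin.zero    Fin.zero    _ = ≡.refl
lookup-injective (x∉xs ∷ _)  Fin.zero    (Fin.suc j) e = ⊥-elim (All.lookup x∉xs (∈-lookup j) e)
lookup-injective (x∉xs ∷ _)  (Fin.suc i) Fin.zero    e = ⊥-elim (All.lookup x∉xs (∈-lookup i) (≡.sym e))
lookup-injective (_ ∷ uxs)   (Fin.suc i) (Fin.suc j) e = ≡.cong Fin.suc (lookup-injective uxs i j e)

prodℕ-∣ : ∀ n (f : Fin n → ℕ) k → f k ∣ prodℕ n f
prodℕ-∣ (suc n) f Fin.zero    = m∣m*n _
prodℕ-∣ (suc n) f (Fin.suc k) = ∣-trans (prodℕ-∣ n (f ∘ Fin.suc) k) (n∣m*n (f Fin.zero))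

prodℕ-*-∣ : ∀ n (f : Fin n → ℕ) k k′ → k ≢ k′ → f k * f k′ ∣ prodℕ n f
prodℕ-*-∣ (suc n) f Fin.zero    Fin.zero     k≢k′ = ⊥-elim (k≢k′ ≡.refl)
prodℕ-*-∣ (suc n) f Fin.zero    (Fin.suc k′) k≢k′ = *-monoʳ-∣ (f Fin.zero) (prodℕ-∣ n _ k′)
prodℕ-*-∣ (suc n) f (Fin.suc k) Fin.zero     k≢k′ =
  ≡.subst (_∣ prodℕ (suc n) f) (ℕ.*-comm (f Fin.zero) _) (*-monoʳ-∣ (f Fin.zero) (prodℕ-∣ n _ k))
prodℕ-*-∣ (suc n) f (Fin.suc k) (Fin.suc k′) k≢k′ =
  ∣-trans (prodℕ-*-∣ n (f ∘ Fin.suc) k k′ (k≢k′ ∘ ≡.cong Fin.suc)) (n∣m*n (f Fin.zero))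

module GroupProducts {c ℓ : Level} (G : Group c ℓ) where
  open Group G
  open import Relation.Binary.Reasoning.Setoid setoid

  infixr 8 _^_
  _^_ : Carrier → ℕ → Carrier
  _^_ = pow G

  ∏ : (n : ℕ) → (Fin n → Carrier) → Carrier
  ∏ = prodFin G

  pow-cong : ∀ {x y} n → x ≈ y → x ^ n ≈ y ^ n
  pow-cong zero    x≈y = refl
  pow-cong (suc n) x≈y = ∙-cong x≈y (pow-cong n x≈y)

  pow-≡ : ∀ x {a b} → a ≡ b → x ^ a ≈ x ^ b
  pow-≡ x ≡.refl = refl

  pow-+ : ∀ x a b → x ^ (a + b) ≈ x ^ a ∙ x ^ b
  pow-+ x zero    b = sym (identityˡ _)
  pow-+ x (suc a) b = trans (∙-congˡ (pow-+ x a b)) (sym (assoc _ _ _))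

  pow-* : ∀ x a b → x ^ (b * a) ≈ (x ^ a) ^ b
  pow-* x a zero    = refl
  pow-* x a (suc b) = trans (pow-+ x a (b * a)) (∙-congˡ (pow-* x a b))

  ε-pow : ∀ n → ε ^ n ≈ ε
  ε-pow zero    = refl
  ε-pow (suc n) = trans (identityˡ _) (ε-pow n)

  pow-≈ε : ∀ {x} n → x ≈ ε → x ^ n ≈ ε
  pow-≈ε n x≈ε = trans (pow-cong n x≈ε) (ε-pow n)

  pow-∣-≈ε : ∀ {x k n} → k ∣ n → x ^ k ≈ ε → x ^ n ≈ ε
  pow-∣-≈ε {x} {k} (divides q n≡q*k) xᵏ≈ε =
    trans (pow-≡ x n≡q*k) (trans (pow-* x k q) (pow-≈ε q xᵏ≈ε))

  pow-comm : ∀ x a b → (x ^ a) ^ b ≈ (x ^ b) ^ a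
  pow-comm x a b = begin
    (x ^ a) ^ b ≈⟨ pow-* x a b ⟨
    x ^ (b * a) ≈⟨ pow-≡ x (ℕ.*-comm b a) ⟩
    x ^ (a * b) ≈⟨ pow-* x b a ⟩
    (x ^ b) ^ a ∎

  ∏-cong : ∀ n {f g : Fin n → Carrier} → (∀ i → f i ≈ g i) → ∏ n f ≈ ∏ n g
  ∏-cong zero    f≈g = refl
  ∏-cong (suc n) f≈g = ∙-cong (f≈g Fin.zero) (∏-cong n (f≈g ∘ Fin.suc))

  ∏-const : ∀ n x → ∏ n (λ _ → x) ≈ x ^ n
  ∏-const zero    x = refl
  ∏-const (suc n) x = ∙-congˡ (∏-const n x)

  ∏-≈ε : ∀ n (f : Fin n → Carrier) → (∀ i → f i ≈ ε) → ∏ n f ≈ ε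
  ∏-≈ε zero    f f≈ε = refl
  ∏-≈ε (suc n) f f≈ε = trans (∙-cong (f≈ε Fin.zero) (∏-≈ε n _ (f≈ε ∘ Fin.suc))) (identityˡ ε)

  ∏-++ : ∀ k n (f : Fin (k + n) → Carrier) →
         ∏ (k + n) f ≈ ∏ k (λ a → f (a ↑ˡ n)) ∙ ∏ n (λ b → f (k ↑ʳ b))
  ∏-++ zero    n f = sym (identityˡ _)
  ∏-++ (suc k) n f = trans (∙-congˡ (∏-++ k n (f ∘ Fin.suc))) (sym (assoc _ _ _))

  ∏-combine : ∀ e k (f : Fin (e * k) → Carrier) →
              ∏ (e * k) f ≈ ∏ e (λ j → ∏ k (λ a → f (combine j a)))
  ∏-combine zero    k f = refl
  ∏-combine (suc e) k f = trans (∏-++ k (e * k) f) (∙-congˡ (∏-combine e k (λ x → f (k ↑ʳ x))))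

  Central-ε : Central G ε
  Central-ε g = trans (identityˡ g) (sym (identityʳ g))

  Central-∙ : ∀ {a b} → Central G a → Central G b → Central G (a ∙ b)
  Central-∙ {a} {b} ca cb g = begin
    (a ∙ b) ∙ g ≈⟨ assoc _ _ _ ⟩
    a ∙ (b ∙ g) ≈⟨ ∙-congˡ (cb g) ⟩
    a ∙ (g ∙ b) ≈⟨ assoc _ _ _ ⟨
    (a ∙ g) ∙ b ≈⟨ ∙-congʳ (ca g) ⟩
    (g ∙ a) ∙ b ≈⟨ assoc _ _ _ ⟩
    g ∙ (a ∙ b) ∎

  Central-pow : ∀ {z} n → Central G z → Central G (z ^ n)
  Central-pow zero    cz = Central-ε
  Central-pow (suc n) cz = Central-∙ cz (Central-pow n cz)

  Central-∏ : ∀ n {f : Fin n → Carrier} → (∀ i → Central G (f i)) → Central G (∏ n f)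
  Central-∏ zero    cf = Central-ε
  Central-∏ (suc n) cf = Central-∙ (cf Fin.zero) (Central-∏ n (cf ∘ Fin.suc))

  central-slide : ∀ {w} → Central G w → ∀ a b → (a ∙ w) ∙ b ≈ (a ∙ b) ∙ w
  central-slide {w} cw a b = begin
    (a ∙ w) ∙ b ≈⟨ assoc _ _ _ ⟩
    a ∙ (w ∙ b) ≈⟨ ∙-congˡ (cw b) ⟩
    a ∙ (b ∙ w) ≈⟨ assoc _ _ _ ⟨
    (a ∙ b) ∙ w ∎

  involution-∙-central : ∀ {a b} → Central G b → a ∙ a ≈ ε → b ∙ b ≈ ε → (a ∙ b) ∙ (a ∙ b) ≈ ε
  involution-∙-central {a} {b} cb a²≈ε b²≈ε = begin
    (a ∙ b) ∙ (a ∙ b)  ≈⟨ assoc _ _ _ ⟩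
    a ∙ (b ∙ (a ∙ b))  ≈⟨ ∙-congˡ (cb _) ⟩
    a ∙ ((a ∙ b) ∙ b)  ≈⟨ ∙-congˡ (assoc _ _ _) ⟩
    a ∙ (a ∙ (b ∙ b))  ≈⟨ ∙-congˡ (∙-congˡ b²≈ε) ⟩
    a ∙ (a ∙ ε)        ≈⟨ ∙-congˡ (identityʳ a) ⟩
    a ∙ a              ≈⟨ a²≈ε ⟩
    ε                  ∎

  pow-∙-central : ∀ {a b} n → Central G b → (a ∙ b) ^ n ≈ a ^ n ∙ b ^ n
  pow-∙-central zero    cb = sym (identityˡ _)
  pow-∙-central {a} {b} (suc n) cb = begin
    (a ∙ b) ∙ (a ∙ b) ^ n       ≈⟨ ∙-congˡ (pow-∙-central n cb) ⟩
    (a ∙ b) ∙ (a ^ n ∙ b ^ n)   ≈⟨ assoc _ _ _ ⟨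
    ((a ∙ b) ∙ a ^ n) ∙ b ^ n   ≈⟨ ∙-congʳ (central-slide cb a (a ^ n)) ⟩
    ((a ∙ a ^ n) ∙ b) ∙ b ^ n   ≈⟨ assoc _ _ _ ⟩
    (a ∙ a ^ n) ∙ (b ∙ b ^ n)   ∎

  ∏-distrib-central : ∀ n (f g : Fin n → Carrier) → (∀ i → Central G (g i)) →
                      ∏ n (λ i → f i ∙ g i) ≈ ∏ n f ∙ ∏ n g
  ∏-distrib-central zero    f g cg = sym (identityˡ _)
  ∏-distrib-central (suc n) f g cg = begin
    (f₀ ∙ g₀) ∙ ∏ n (λ i → f (Fin.suc i) ∙ g (Fin.suc i))
      ≈⟨ ∙-congˡ (∏-distrib-central n _ _ (cg ∘ Fin.suc)) ⟩
    (f₀ ∙ g₀) ∙ (∏ n (f ∘ Fin.suc) ∙ ∏ n (g ∘ Fin.suc))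
      ≈⟨ assoc _ _ _ ⟨
    ((f₀ ∙ g₀) ∙ ∏ n (f ∘ Fin.suc)) ∙ ∏ n (g ∘ Fin.suc)
      ≈⟨ ∙-congʳ (central-slide (cg Fin.zero) _ _) ⟩
    ((f₀ ∙ ∏ n (f ∘ Fin.suc)) ∙ g₀) ∙ ∏ n (g ∘ Fin.suc)
      ≈⟨ assoc _ _ _ ⟩
    (f₀ ∙ ∏ n (f ∘ Fin.suc)) ∙ (g₀ ∙ ∏ n (g ∘ Fin.suc)) ∎
    where f₀ = f Fin.zero
          g₀ = g Fin.zero

  ∏-central-except-last : ∀ n (f : Fin n → Carrier) z w → Central G w → 0 < n →
    (∀ a → suc (toℕ a) ≡ n → f a ≈ z ∙ w) → (∀ a → suc (toℕ a) ≢ n → f a ≈ w) →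
    ∏ n f ≈ z ∙ w ^ n
  ∏-central-except-last (suc zero) f z w cw _ last _ =
    trans (identityʳ _) (trans (last Fin.zero ≡.refl) (∙-congˡ (sym (identityʳ w))))
  ∏-central-except-last (suc (suc n)) f z w cw _ last other = begin
    f Fin.zero ∙ ∏ (suc n) (f ∘ Fin.suc)
      ≈⟨ ∙-cong (other Fin.zero (λ ())) (∏-central-except-last (suc n) _ z w cw (s≤s z≤n)
                  (λ a e → last (Fin.suc a) (≡.cong suc e))
                  (λ a ne → other (Fin.suc a) (ne ∘ ℕ.suc-injective))) ⟩
    w ∙ (z ∙ w ^ suc n) ≈⟨ assoc _ _ _ ⟨
    (w ∙ z) ∙ w ^ suc n ≈⟨ ∙-congʳ (cw z) ⟩
    (z ∙ w) ∙ w ^ suc n ≈⟨ assoc _ _ _ ⟩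
    z ∙ w ^ suc (suc n) ∎

module CommutingProducts {c ℓ p r : Level} (G : Group c ℓ)
  (P : Pred (Group.Carrier G) p) (P-ε : P (Group.ε G))
  (P-∙ : ∀ {x y} → P x → P y → P (Group._∙_ G x y))
  (_~_ : Rel (Group.Carrier G) r) (~-isEquivalence : IsEquivalence _~_)
  (≈⇒~ : ∀ {x y} → Group._≈_ G x y → x ~ y)
  (~-∙ : ∀ {x x′ y y′} → x ~ x′ → y ~ y′ → Group._∙_ G x y ~ Group._∙_ G x′ y′)
  (~-comm : ∀ {x y} → P x → P y → Group._∙_ G x y ~ Group._∙_ G y x)
  where
  open Group G
  open GroupProducts G using (∏)
  open IsEquivalence ~-isEquivalence renaming (refl to ~-refl; sym to ~-sym; trans to ~-trans)

  private
    M : CommutativeMonoid (c ⊔ p) r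
    M = record
      { Carrier = Σ Carrier P
      ; _≈_ = λ x y → proj₁ x ~ proj₁ y
      ; _∙_ = λ x y → (proj₁ x ∙ proj₁ y) , P-∙ (proj₂ x) (proj₂ y)
      ; ε = ε , P-ε
      ; isCommutativeMonoid = record
        { isMonoid = record
          { isSemigroup = record
            { isMagma = record
              { isEquivalence = record { refl = ~-refl ; sym = ~-sym ; trans = ~-trans }
              ; ∙-cong = ~-∙ }
            ; assoc = λ x y z → ≈⇒~ (assoc (proj₁ x) (proj₁ y) (proj₁ z)) }
          ; identity = (λ x → ≈⇒~ (identityˡ (proj₁ x))) , (λ x → ≈⇒~ (identityʳ (proj₁ x))) }
        ; comm = λ x y → ~-comm (proj₂ x) (proj₂ y) } }

    module Sum = MonoidSum M

    lift-∏ : ∀ n (f : Fin n → Carrier) (Pf : ∀ i → P (f i)) → ∏ n f ≡ proj₁ (Sum.sum (λ i → f i , Pf i))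
    lift-∏ zero    f Pf = ≡.refl
    lift-∏ (suc n) f Pf = ≡.cong (f Fin.zero ∙_) (lift-∏ n (f ∘ Fin.suc) (Pf ∘ Fin.suc))

  ∏-cong~ : ∀ n {f g : Fin n → Carrier} → (∀ i → f i ~ g i) → ∏ n f ~ ∏ n g
  ∏-cong~ zero    f~g = ~-refl
  ∏-cong~ (suc n) f~g = ~-∙ (f~g Fin.zero) (∏-cong~ n (f~g ∘ Fin.suc))

  ∏-∈ : ∀ n {f : Fin n → Carrier} → (∀ i → P (f i)) → P (∏ n f)
  ∏-∈ zero    Pf = P-ε
  ∏-∈ (suc n) Pf = P-∙ (Pf Fin.zero) (∏-∈ n (Pf ∘ Fin.suc))

  ∏-permute : ∀ {n k} (f : Fin n → Carrier) → (∀ i → P (f i)) → (σ : Permutation k n) →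
              ∏ n f ~ ∏ k (f ∘ (σ ⟨$⟩ʳ_))
  ∏-permute {n} {k} f Pf σ =
    ≡.subst₂ _~_ (≡.sym (lift-∏ n f Pf)) (≡.sym (lift-∏ k _ (Pf ∘ (σ ⟨$⟩ʳ_))))
      (Sum.sum-permute (λ i → f i , Pf i) σ)

  ∏-distrib : ∀ n (f g : Fin n → Carrier) → (∀ i → P (f i)) → (∀ i → P (g i)) →
              ∏ n (λ i → f i ∙ g i) ~ (∏ n f ∙ ∏ n g)
  ∏-distrib n f g Pf Pg =
    ≡.subst₂ _~_ (≡.sym (lift-∏ n _ (λ i → P-∙ (Pf i) (Pg i))))
      (≡.cong₂ _∙_ (≡.sym (lift-∏ n f Pf)) (≡.sym (lift-∏ n g Pg)))
      (Sum.∑-distrib-+ (λ i → f i , Pf i) (λ i → g i , Pg i))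

module Commutators {c ℓ : Level} (G : Group c ℓ) where
  open Group G
  open import Algebra.Properties.Group G
  open import Relation.Binary.Reasoning.Setoid setoid

  [_,_] : Carrier → Carrier → Carrier
  [_,_] = comm G

  comm-expand : ∀ x y → [ x , y ] ≈ x ⁻¹ ∙ (y ⁻¹ ∙ (x ∙ y))
  comm-expand x y = trans (assoc _ _ _) (assoc _ _ _)

  ∙-swap : ∀ x y → x ∙ y ≈ (y ∙ x) ∙ [ x , y ]
  ∙-swap x y = sym (begin
    (y ∙ x) ∙ [ x , y ]                  ≈⟨ ∙-congˡ (comm-expand x y) ⟩
    (y ∙ x) ∙ (x ⁻¹ ∙ (y ⁻¹ ∙ (x ∙ y)))  ≈⟨ assoc _ _ _ ⟩
    y ∙ (x ∙ (x ⁻¹ ∙ (y ⁻¹ ∙ (x ∙ y))))  ≈⟨ ∙-congˡ (\\-leftDividesˡ _ _) ⟩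
    y ∙ (y ⁻¹ ∙ (x ∙ y))                 ≈⟨ \\-leftDividesˡ _ _ ⟩
    x ∙ y                                ∎)

  conjugate : ∀ g x → (x ⁻¹ ∙ g) ∙ x ≈ g ∙ [ g , x ]
  conjugate g x = sym (begin
    g ∙ [ g , x ]                  ≈⟨ ∙-congˡ (comm-expand g x) ⟩
    g ∙ (g ⁻¹ ∙ (x ⁻¹ ∙ (g ∙ x)))  ≈⟨ \\-leftDividesˡ _ _ ⟩
    x ⁻¹ ∙ (g ∙ x)                 ≈⟨ assoc _ _ _ ⟨
    (x ⁻¹ ∙ g) ∙ x                 ∎)

  comm≈ε⇒commute : ∀ {x y} → [ x , y ] ≈ ε → x ∙ y ≈ y ∙ x
  comm≈ε⇒commute {x} {y} e = trans (∙-swap x y) (trans (∙-congˡ e) (identityʳ _))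

  commute⇒comm≈ε : ∀ {x y} → x ∙ y ≈ y ∙ x → [ x , y ] ≈ ε
  commute⇒comm≈ε {x} {y} e = begin
    [ x , y ]                ≈⟨ comm-expand x y ⟩
    x ⁻¹ ∙ (y ⁻¹ ∙ (x ∙ y))  ≈⟨ ∙-congˡ (∙-congˡ e) ⟩
    x ⁻¹ ∙ (y ⁻¹ ∙ (y ∙ x))  ≈⟨ ∙-congˡ (\\-leftDividesʳ _ _) ⟩
    x ⁻¹ ∙ x                 ≈⟨ inverseˡ x ⟩
    ε                        ∎

  comm-congˡ : ∀ {x x′} y → x ≈ x′ → [ x , y ] ≈ [ x′ , y ]
  comm-congˡ y e = ∙-congʳ (∙-cong (∙-congʳ (⁻¹-cong e)) e)

  comm-congʳ : ∀ x {y y′} → y ≈ y′ → [ x , y ] ≈ [ x , y′ ]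
  comm-congʳ x e = ∙-cong (∙-congʳ (∙-congˡ (⁻¹-cong e))) e

  comm-self : ∀ x → [ x , x ] ≈ ε
  comm-self x = commute⇒comm≈ε refl

  comm-εˡ : ∀ y → [ ε , y ] ≈ ε
  comm-εˡ y = commute⇒comm≈ε (trans (identityˡ y) (sym (identityʳ y)))

  comm-εʳ : ∀ x → [ x , ε ] ≈ ε
  comm-εʳ x = commute⇒comm≈ε (trans (identityʳ x) (sym (identityˡ x)))

module ClassTwo {c ℓ : Level} (G : Group c ℓ)
  (class2 : ∀ x y z → Group._≈_ G (comm G z (comm G x y)) (Group.ε G)) where
  open Group G
  open import Algebra.Properties.Group G
  open import Relation.Binary.Reasoning.Setoid setoid
  open GroupProducts G
  open Commutators G

  comm-central : ∀ x y → Central G [ x , y ]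
  comm-central x y g = sym (comm≈ε⇒commute (class2 x y g))

  comm-bilinearˡ : ∀ x y z → [ x ∙ y , z ] ≈ [ x , z ] ∙ [ y , z ]
  comm-bilinearˡ x y z = ∙-cancelˡ (z ∙ (x ∙ y)) _ _ (begin
    (z ∙ (x ∙ y)) ∙ [ x ∙ y , z ]            ≈⟨ ∙-swap _ _ ⟨
    (x ∙ y) ∙ z                              ≈⟨ assoc _ _ _ ⟩
    x ∙ (y ∙ z)                              ≈⟨ ∙-congˡ (∙-swap y z) ⟩
    x ∙ ((z ∙ y) ∙ [ y , z ])                ≈⟨ assoc _ _ _ ⟨
    (x ∙ (z ∙ y)) ∙ [ y , z ]                ≈⟨ ∙-congʳ (assoc _ _ _) ⟨
    ((x ∙ z) ∙ y) ∙ [ y , z ]                ≈⟨ ∙-congʳ (∙-congʳ (∙-swap x z)) ⟩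
    (((z ∙ x) ∙ [ x , z ]) ∙ y) ∙ [ y , z ]  ≈⟨ ∙-congʳ (central-slide (comm-central x z) _ _) ⟩
    (((z ∙ x) ∙ y) ∙ [ x , z ]) ∙ [ y , z ]  ≈⟨ assoc _ _ _ ⟩
    ((z ∙ x) ∙ y) ∙ ([ x , z ] ∙ [ y , z ])  ≈⟨ ∙-congʳ (assoc _ _ _) ⟩
    (z ∙ (x ∙ y)) ∙ ([ x , z ] ∙ [ y , z ])  ∎)

  comm-inverse : ∀ x y → [ x , y ] ≈ [ y , x ] ⁻¹
  comm-inverse x y = inverseʳ-unique _ _ (∙-cancelˡ (x ∙ y) _ _ (begin
    (x ∙ y) ∙ ([ y , x ] ∙ [ x , y ])  ≈⟨ assoc _ _ _ ⟨
    ((x ∙ y) ∙ [ y , x ]) ∙ [ x , y ]  ≈⟨ ∙-congʳ (∙-swap y x) ⟨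
    (y ∙ x) ∙ [ x , y ]                ≈⟨ ∙-swap x y ⟨
    x ∙ y                              ≈⟨ identityʳ _ ⟨
    (x ∙ y) ∙ ε                        ∎))

  comm-bilinearʳ : ∀ x y z → [ x , y ∙ z ] ≈ [ x , y ] ∙ [ x , z ]
  comm-bilinearʳ x y z = begin
    [ x , y ∙ z ]                  ≈⟨ comm-inverse _ _ ⟩
    [ y ∙ z , x ] ⁻¹               ≈⟨ ⁻¹-cong (comm-bilinearˡ _ _ _) ⟩
    ([ y , x ] ∙ [ z , x ]) ⁻¹     ≈⟨ ⁻¹-anti-homo-∙ _ _ ⟩
    [ z , x ] ⁻¹ ∙ [ y , x ] ⁻¹    ≈⟨ ∙-cong (comm-inverse _ _) (comm-inverse _ _) ⟨
    [ x , z ] ∙ [ x , y ]          ≈⟨ comm-central x z _ ⟩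
    [ x , y ] ∙ [ x , z ]          ∎

  comm-powˡ : ∀ x y n → [ x ^ n , y ] ≈ [ x , y ] ^ n
  comm-powˡ x y zero    = comm-εˡ y
  comm-powˡ x y (suc n) = trans (comm-bilinearˡ _ _ _) (∙-congˡ (comm-powˡ x y n))

  comm-powʳ : ∀ x y n → [ x , y ^ n ] ≈ [ x , y ] ^ n
  comm-powʳ x y zero    = comm-εʳ x
  comm-powʳ x y (suc n) = trans (comm-bilinearʳ _ _ _) (∙-congˡ (comm-powʳ x y n))

  comm-∏ˡ : ∀ y n (f : Fin n → Carrier) → [ ∏ n f , y ] ≈ ∏ n (λ i → [ f i , y ])
  comm-∏ˡ y zero    f = comm-εˡ y
  comm-∏ˡ y (suc n) f = trans (comm-bilinearˡ _ _ _) (∙-congˡ (comm-∏ˡ y n _))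

  comm-∏ʳ : ∀ x n (f : Fin n → Carrier) → [ x , ∏ n f ] ≈ ∏ n (λ i → [ x , f i ])
  comm-∏ʳ x zero    f = comm-εʳ x
  comm-∏ʳ x (suc n) f = trans (comm-bilinearʳ _ _ _) (∙-congˡ (comm-∏ʳ x n _))

  pow-∙ : ∀ x y n → (x ∙ y) ^ n ≈ (x ^ n ∙ y ^ n) ∙ [ y , x ] ^ (n C 2)
  pow-∙ x y zero    = sym (trans (identityʳ _) (identityˡ _))
  pow-∙ x y (suc n) = begin
    (x ∙ y) ∙ (x ∙ y) ^ n                                   ≈⟨ ∙-congˡ (pow-∙ x y n) ⟩
    (x ∙ y) ∙ ((x ^ n ∙ y ^ n) ∙ w ^ (n C 2))               ≈⟨ assoc _ _ _ ⟨
    ((x ∙ y) ∙ (x ^ n ∙ y ^ n)) ∙ w ^ (n C 2)               ≈⟨ ∙-congʳ step ⟩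
    (((x ∙ x ^ n) ∙ (y ∙ y ^ n)) ∙ w ^ n) ∙ w ^ (n C 2)     ≈⟨ assoc _ _ _ ⟩
    ((x ∙ x ^ n) ∙ (y ∙ y ^ n)) ∙ (w ^ n ∙ w ^ (n C 2))     ≈⟨ ∙-congˡ (pow-+ w n (n C 2)) ⟨
    ((x ∙ x ^ n) ∙ (y ∙ y ^ n)) ∙ w ^ (n + n C 2)          ≈⟨ ∙-congˡ (pow-≡ w (≡.sym (suc-C2 n))) ⟩
    ((x ∙ x ^ n) ∙ (y ∙ y ^ n)) ∙ w ^ (suc n C 2)          ∎
    where
      w = [ y , x ]
      step : (x ∙ y) ∙ (x ^ n ∙ y ^ n) ≈ ((x ∙ x ^ n) ∙ (y ∙ y ^ n)) ∙ w ^ n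
      step = begin
        (x ∙ y) ∙ (x ^ n ∙ y ^ n)                  ≈⟨ assoc _ _ _ ⟩
        x ∙ (y ∙ (x ^ n ∙ y ^ n))                  ≈⟨ ∙-congˡ (assoc _ _ _) ⟨
        x ∙ ((y ∙ x ^ n) ∙ y ^ n)                  ≈⟨ ∙-congˡ (∙-congʳ (∙-swap y (x ^ n))) ⟩
        x ∙ (((x ^ n ∙ y) ∙ [ y , x ^ n ]) ∙ y ^ n)  ≈⟨ ∙-congˡ (central-slide (comm-central _ _) _ _) ⟩
        x ∙ (((x ^ n ∙ y) ∙ y ^ n) ∙ [ y , x ^ n ])  ≈⟨ assoc _ _ _ ⟨
        (x ∙ ((x ^ n ∙ y) ∙ y ^ n)) ∙ [ y , x ^ n ]  ≈⟨ ∙-cong (∙-congˡ (assoc _ _ _)) (comm-powʳ y x n) ⟩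
        (x ∙ (x ^ n ∙ (y ∙ y ^ n))) ∙ w ^ n        ≈⟨ ∙-congʳ (assoc _ _ _) ⟨
        ((x ∙ x ^ n) ∙ (y ∙ y ^ n)) ∙ w ^ n        ∎

module Transfer {c ℓ p : Level} (G : Group c ℓ) {H : Pred (Group.Carrier G) p}
  (H-subgroup : IsSubgroup G H)
  (H-abelian : ∀ {x y} → H x → H y → Group._≈_ G (Group._∙_ G x y) (Group._∙_ G y x)) where
  open Group G
  open import Algebra.Properties.Group G
  open import Relation.Binary.Reasoning.Setoid setoid
  open GroupProducts G
  open IsSubgroup H-subgroup renaming (resp to H-resp; ε∈ to H-ε; ∙∈ to H-∙; ⁻¹∈ to H-⁻¹)
  open CommutingProducts G H H-ε H-∙ _≈_ isEquivalence (λ e → e) ∙-cong H-abelian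
    using (∏-∈; ∏-permute; ∏-distrib)

  infix 4 _∼_
  _∼_ : Carrier → Carrier → Set p
  x ∼ y = H (x ⁻¹ ∙ y)

  ≈⇒∼ : ∀ {x y} → x ≈ y → x ∼ y
  ≈⇒∼ {x} {y} x≈y = H-resp (trans (sym (inverseˡ x)) (∙-congˡ x≈y)) H-ε

  ∼-sym : ∀ {x y} → x ∼ y → y ∼ x
  ∼-sym {x} {y} x∼y = H-resp (trans (⁻¹-anti-homo-∙ _ _) (∙-congˡ (⁻¹-involutive x))) (H-⁻¹ x∼y)

  ∼-trans : ∀ {x y z} → x ∼ y → y ∼ z → x ∼ z
  ∼-trans {x} {y} {z} x∼y y∼z = H-resp eq (H-∙ x∼y y∼z)
    where
    eq : (x ⁻¹ ∙ y) ∙ (y ⁻¹ ∙ z) ≈ x ⁻¹ ∙ z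
    eq = trans (assoc _ _ _) (∙-congˡ (\\-leftDividesˡ y z))

  ∙-∼ : ∀ g {x y} → x ∼ y → g ∙ x ∼ g ∙ y
  ∙-∼ g {x} {y} = H-resp (sym (begin
    (g ∙ x) ⁻¹ ∙ (g ∙ y)      ≈⟨ ∙-congʳ (⁻¹-anti-homo-∙ g x) ⟩
    (x ⁻¹ ∙ g ⁻¹) ∙ (g ∙ y)   ≈⟨ assoc _ _ _ ⟩
    x ⁻¹ ∙ (g ⁻¹ ∙ (g ∙ y))   ≈⟨ ∙-congˡ (\\-leftDividesʳ g y) ⟩
    x ⁻¹ ∙ y                  ∎))

  module _ {n : ℕ} (T : LeftTransversal G H n) where
    open LeftTransversal T

    idx-cong : ∀ {x y} → x ∼ y → idx x ≡ idx y
    idx-cong {x} {y} x∼y = distinct _ _ (∼-trans (idx-spec x) (∼-trans x∼y (∼-sym (idx-spec y))))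

    idx-t : ∀ j → idx (t j) ≡ j
    idx-t j = distinct _ _ (idx-spec (t j))

    t-cong : ∀ {i j} → i ≡ j → t i ≈ t j
    t-cong ≡.refl = refl

    factor : Carrier → Fin n → Carrier
    factor g i = (t (idx (g ∙ t i)) ⁻¹ ∙ g) ∙ t i

    factor-∈ : ∀ g i → H (factor g i)
    factor-∈ g i = H-resp (sym (assoc _ _ _)) (idx-spec (g ∙ t i))

    translation : Carrier → Permutation n n
    translation g = permutation (λ i → idx (g ∙ t i)) (λ i → idx (g ⁻¹ ∙ t i))
      (λ j → ≡.trans (idx-cong (∼-trans (∙-∼ _ (idx-spec _)) (≈⇒∼ (\\-leftDividesˡ g (t j))))) (idx-t j))
      (λ j → ≡.trans (idx-cong (∼-trans (∙-∼ _ (idx-spec _)) (≈⇒∼ (\\-leftDividesʳ g (t j))))) (idx-t j))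

    transfer-cong : ∀ {g g′} → g ≈ g′ → transfer G T g ≈ transfer G T g′
    transfer-cong g≈g′ = ∏-cong n (λ i →
      ∙-congʳ (∙-cong (⁻¹-cong (t-cong (idx-cong (≈⇒∼ (∙-congʳ g≈g′))))) g≈g′))

    transfer-∈ : ∀ g → H (transfer G T g)
    transfer-∈ g = ∏-∈ n (factor-∈ g)

    transfer-∙ : ∀ x y → transfer G T (x ∙ y) ≈ transfer G T x ∙ transfer G T y
    transfer-∙ x y = begin
      ∏ n (factor (x ∙ y))                          ≈⟨ ∏-cong n split ⟩
      ∏ n (λ i → factor x (σ ⟨$⟩ʳ i) ∙ factor y i)  ≈⟨ ∏-distrib n _ _ (factor-∈ x ∘ (σ ⟨$⟩ʳ_)) (factor-∈ y) ⟩
      ∏ n (factor x ∘ (σ ⟨$⟩ʳ_)) ∙ ∏ n (factor y)   ≈⟨ ∙-congʳ (∏-permute (factor x) (factor-∈ x) σ) ⟨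
      ∏ n (factor x) ∙ ∏ n (factor y)               ∎
      where
      σ = translation y
      split : ∀ i → factor (x ∙ y) i ≈ factor x (σ ⟨$⟩ʳ i) ∙ factor y i
      split i = sym (begin
        ((a ⁻¹ ∙ x) ∙ b) ∙ ((b ⁻¹ ∙ y) ∙ t i)  ≈⟨ assoc _ _ _ ⟩
        (a ⁻¹ ∙ x) ∙ (b ∙ ((b ⁻¹ ∙ y) ∙ t i))  ≈⟨ ∙-congˡ (∙-congˡ (assoc _ _ _)) ⟩
        (a ⁻¹ ∙ x) ∙ (b ∙ (b ⁻¹ ∙ (y ∙ t i)))  ≈⟨ ∙-congˡ (\\-leftDividesˡ _ _) ⟩
        (a ⁻¹ ∙ x) ∙ (y ∙ t i)                 ≈⟨ assoc _ _ _ ⟨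
        ((a ⁻¹ ∙ x) ∙ y) ∙ t i                 ≈⟨ ∙-congʳ (assoc _ _ _) ⟩
        (a ⁻¹ ∙ (x ∙ y)) ∙ t i                 ≈⟨ ∙-congʳ (∙-congʳ (⁻¹-cong (t-cong same-coset))) ⟩
        factor (x ∙ y) i                        ∎)
        where
        b = t (σ ⟨$⟩ʳ i)
        a = t (idx (x ∙ b))
        same-coset : idx (x ∙ b) ≡ idx ((x ∙ y) ∙ t i)
        same-coset = idx-cong (∼-trans (∙-∼ x (idx-spec (y ∙ t i))) (≈⇒∼ (sym (assoc x y (t i)))))

    transfer-ε : transfer G T ε ≈ ε
    transfer-ε = ∙-cancelˡ (transfer G T ε) _ _
      (trans (sym (transfer-∙ ε ε)) (trans (transfer-cong (identityˡ ε)) (sym (identityʳ _))))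

    transfer-pow : ∀ x k → transfer G T (x ^ k) ≈ transfer G T x ^ k
    transfer-pow x zero    = transfer-ε
    transfer-pow x (suc k) = trans (transfer-∙ _ _) (∙-congˡ (transfer-pow x k))

    transfer-∏ : ∀ k f → transfer G T (∏ k f) ≈ ∏ k (transfer G T ∘ f)
    transfer-∏ zero    f = transfer-ε
    transfer-∏ (suc k) f = trans (transfer-∙ _ _) (∙-congˡ (transfer-∏ k _))

  module _ {n₁ n₂ : ℕ} (T₁ : LeftTransversal G H n₁) (T₂ : LeftTransversal G H n₂) where
    private
      module T₁ = LeftTransversal T₁
      module T₂ = LeftTransversal T₂

    matching : Permutation n₁ n₂
    matching = permutation (λ j → T₂.idx (T₁.t j)) (λ i → T₁.idx (T₂.t i))
      (λ i → ≡.trans (idx-cong T₂ (T₁.idx-spec (T₂.t i))) (idx-t T₂ i))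
      (λ j → ≡.trans (idx-cong T₁ (T₂.idx-spec (T₁.t j))) (idx-t T₁ j))

    index-unique : n₁ ≡ n₂
    index-unique = Perm.↔⇒≡ matching

    -- T₁.t j = T₂.t (τ j) ∙ η j with η j ∈ H; the η⁻¹ occurring in the factors are a
    -- permutation of the η j, so everything cancels in the abelian group H.
    transfer-independent : ∀ g → transfer G T₁ g ≈ transfer G T₂ g
    transfer-independent g = begin
      ∏ n₁ (factor T₁ g)                            ≈⟨ ∏-cong n₁ regroup ⟩
      ∏ n₁ (λ j → η′ j ∙ (F₂ j ∙ η j))              ≈⟨ ∏-distrib n₁ η′ _ η′-∈ (λ j → H-∙ (F₂-∈ j) (η-∈ j)) ⟩
      ∏ n₁ η′ ∙ ∏ n₁ (λ j → F₂ j ∙ η j)             ≈⟨ ∙-congˡ (∏-distrib n₁ F₂ η F₂-∈ η-∈) ⟩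
      ∏ n₁ η′ ∙ (∏ n₁ F₂ ∙ ∏ n₁ η)                  ≈⟨ ∙-cong (∏-permute (λ j → η j ⁻¹) (H-⁻¹ ∘ η-∈) (translation T₁ g))
                                                              (∙-congʳ (∏-permute (factor T₂ g) (factor-∈ T₂ g) matching)) ⟨
      ∏ n₁ (λ j → η j ⁻¹) ∙ (Tr₂ ∙ ∏ n₁ η)          ≈⟨ ∙-congˡ (H-abelian (transfer-∈ T₂ g) (∏-∈ n₁ η-∈)) ⟩
      ∏ n₁ (λ j → η j ⁻¹) ∙ (∏ n₁ η ∙ Tr₂)          ≈⟨ assoc _ _ _ ⟨
      (∏ n₁ (λ j → η j ⁻¹) ∙ ∏ n₁ η) ∙ Tr₂          ≈⟨ ∙-congʳ (∏-distrib n₁ _ _ (H-⁻¹ ∘ η-∈) η-∈) ⟨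
      ∏ n₁ (λ j → η j ⁻¹ ∙ η j) ∙ Tr₂               ≈⟨ ∙-congʳ (∏-≈ε n₁ _ (λ j → inverseˡ _)) ⟩
      ε ∙ Tr₂                                       ≈⟨ identityˡ _ ⟩
      Tr₂                                           ∎
      where
      Tr₂ = transfer G T₂ g
      τ : Fin n₁ → Fin n₂
      τ = matching ⟨$⟩ʳ_
      η : Fin n₁ → Carrier
      η j = T₂.t (τ j) ⁻¹ ∙ T₁.t j
      η-∈ : ∀ j → H (η j)
      η-∈ j = T₂.idx-spec (T₁.t j)
      η′ : Fin n₁ → Carrier
      η′ j = η (T₁.idx (g ∙ T₁.t j)) ⁻¹
      η′-∈ : ∀ j → H (η′ j)
      η′-∈ j = H-⁻¹ (η-∈ _)
      F₂ : Fin n₁ → Carrier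
      F₂ = factor T₂ g ∘ τ
      F₂-∈ : ∀ j → H (F₂ j)
      F₂-∈ j = factor-∈ T₂ g (τ j)
      t₁≈ : ∀ j → T₁.t j ≈ T₂.t (τ j) ∙ η j
      t₁≈ j = sym (\\-leftDividesˡ _ _)
      τ-translation : ∀ j → τ (T₁.idx (g ∙ T₁.t j)) ≡ T₂.idx (g ∙ T₂.t (τ j))
      τ-translation j = ≡.trans (idx-cong T₂ (T₁.idx-spec _))
                                (idx-cong T₂ (∙-∼ g (∼-sym (T₂.idx-spec (T₁.t j)))))
      regroup : ∀ j → factor T₁ g j ≈ η′ j ∙ (F₂ j ∙ η j)
      regroup j = begin
        (T₁.t k ⁻¹ ∙ g) ∙ T₁.t j                                 ≈⟨ ∙-cong (∙-congʳ (⁻¹-cong (t₁≈ k))) (t₁≈ j) ⟩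
        ((T₂.t (τ k) ∙ η k) ⁻¹ ∙ g) ∙ (T₂.t (τ j) ∙ η j)         ≈⟨ ∙-congʳ (∙-congʳ (⁻¹-anti-homo-∙ _ _)) ⟩
        ((η k ⁻¹ ∙ T₂.t (τ k) ⁻¹) ∙ g) ∙ (T₂.t (τ j) ∙ η j)      ≈⟨ ∙-congʳ (assoc _ _ _) ⟩
        (η k ⁻¹ ∙ (T₂.t (τ k) ⁻¹ ∙ g)) ∙ (T₂.t (τ j) ∙ η j)      ≈⟨ assoc _ _ _ ⟩
        η k ⁻¹ ∙ ((T₂.t (τ k) ⁻¹ ∙ g) ∙ (T₂.t (τ j) ∙ η j))      ≈⟨ ∙-congˡ (assoc _ _ _) ⟨
        η k ⁻¹ ∙ (((T₂.t (τ k) ⁻¹ ∙ g) ∙ T₂.t (τ j)) ∙ η j)      ≈⟨ ∙-congˡ (∙-congʳ (∙-congʳ (∙-congʳ (⁻¹-cong (t-cong T₂ (τ-translation j)))))) ⟩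
        η′ j ∙ (F₂ j ∙ η j)                                      ∎
        where k = T₁.idx (g ∙ T₁.t j)

module ClassTwoTransfer {c ℓ p : Level} (G : Group c ℓ) (S : Setting G p) where
  open Group G
  open Setting S
  open import Algebra.Properties.Group G
  open import Relation.Binary.Reasoning.Setoid setoid
  open GroupProducts G
  open Commutators G
  open ClassTwo G class2
  open IsSubgroup (IsNormalSubgroup.isSubgroup H-normal)
    renaming (resp to H-resp; ε∈ to H-ε; ∙∈ to H-∙; ⁻¹∈ to H-⁻¹)
  open Transfer G (IsNormalSubgroup.isSubgroup H-normal) H-abelian
  open LeftTransversal T using (t; idx; idx-spec)

  instance
    m-nonZero : ∀ {i} → NonZero (m i)
    m-nonZero {i} = m-nz i

  -- The kernel relation of π

  infix 4 _≡π_
  _≡π_ : Carrier → Carrier → Set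
  x ≡π y = ∀ i → π x i ≡ π y i

  ≡π-isEquivalence : IsEquivalence _≡π_
  ≡π-isEquivalence = record
    { refl = λ i → ≡.refl ; sym = λ e i → ≡.sym (e i) ; trans = λ e f i → ≡.trans (e i) (f i) }

  open IsEquivalence ≡π-isEquivalence using () renaming (refl to ≡π-refl; sym to ≡π-sym; trans to ≡π-trans)

  ≈⇒≡π : ∀ {x y} → x ≈ y → x ≡π y
  ≈⇒≡π = π-resp

  ≡π-∙ : ∀ {x x′ y y′} → x ≡π x′ → y ≡π y′ → x ∙ y ≡π x′ ∙ y′
  ≡π-∙ {x} {x′} {y} {y′} e f i = Fin.toℕ-injective (≡.trans (π-hom x y i)
    (≡.trans (≡.cong₂ (λ a b → (toℕ a + toℕ b) % m i) (e i) (f i)) (≡.sym (π-hom x′ y′ i))))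

  ≡π-comm : ∀ x y → x ∙ y ≡π y ∙ x
  ≡π-comm x y i = Fin.toℕ-injective (≡.trans (π-hom x y i)
    (≡.trans (≡.cong (_% m i) (ℕ.+-comm (toℕ (π x i)) (toℕ (π y i)))) (≡.sym (π-hom y x i))))

  π-ε : ∀ i → toℕ (π ε i) ≡ 0
  π-ε = π-ker ε H-ε

  ∈H⇒≡πε : ∀ {x} → H x → x ≡π ε
  ∈H⇒≡πε {x} x∈H i = Fin.toℕ-injective (≡.trans (π-ker x x∈H i) (≡.sym (π-ε i)))

  ≡πε⇒∈H : ∀ {x} → x ≡π ε → H x
  ≡πε⇒∈H {x} e = π-ker⁻¹ x (λ i → ≡.trans (≡.cong toℕ (e i)) (π-ε i))

  ≡π⇒∼ : ∀ {x y} → x ≡π y → x ∼ y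
  ≡π⇒∼ {x} {y} e = ≡πε⇒∈H (≡π-trans (≡π-∙ ≡π-refl (≡π-sym e)) (≈⇒≡π (inverseˡ x)))

  ∼⇒≡π : ∀ {x y} → x ∼ y → x ≡π y
  ∼⇒≡π {x} {y} x∼y = ≡π-trans (≈⇒≡π (sym (identityʳ x)))
    (≡π-trans (≡π-∙ ≡π-refl (≡π-sym (∈H⇒≡πε x∼y))) (≈⇒≡π (\\-leftDividesˡ x y)))

  ≡π-⁻¹ : ∀ {x y} → x ≡π y → x ⁻¹ ≡π y ⁻¹
  ≡π-⁻¹ {x} {y} e = ≡π-trans (≈⇒≡π (sym (//-rightDividesʳ y (x ⁻¹))))
    (≡π-trans (≡π-∙ (≡π-∙ ≡π-refl (≡π-sym e)) ≡π-refl)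
      (≈⇒≡π (trans (∙-congʳ (inverseˡ x)) (identityˡ _))))

  ≡π-inverse-unique : ∀ {x y} → x ∙ y ≡π ε → y ≡π x ⁻¹
  ≡π-inverse-unique {x} {y} e = ≡π-trans (≈⇒≡π (sym (\\-leftDividesʳ x y)))
    (≡π-trans (≡π-∙ ≡π-refl e) (≈⇒≡π (identityʳ _)))

  ≡π-cancelˡ : ∀ {x y y′} → x ∙ y ≡π x ∙ y′ → y ≡π y′
  ≡π-cancelˡ {x} {y} {y′} e = ≡π-trans (≈⇒≡π (sym (\\-leftDividesʳ x y)))
    (≡π-trans (≡π-∙ ≡π-refl e) (≈⇒≡π (\\-leftDividesʳ x y′)))

  ≡π-transpose : ∀ {x y x′ y′} → x ∙ y ≡π x′ ∙ y′ → x ⁻¹ ∙ x′ ≡π y ∙ y′ ⁻¹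
  ≡π-transpose {x} {y} {x′} {y′} e = ≡π-cancelˡ (≡π-trans (≈⇒≡π (\\-leftDividesˡ x x′))
    (≡π-trans (≈⇒≡π (sym (//-rightDividesʳ y′ x′)))
      (≡π-trans (≡π-∙ (≡π-sym e) ≡π-refl) (≈⇒≡π (assoc x y (y′ ⁻¹))))))

  open CommutingProducts G (λ _ → ⊤) tt (λ _ _ → tt)
    _≡π_ ≡π-isEquivalence ≈⇒≡π ≡π-∙ (λ {x} {y} _ _ → ≡π-comm x y)
    using () renaming (∏-cong~ to ∏-cong-≡π; ∏-permute to ∏-permute-≡π; ∏-distrib to ∏-distrib-≡π)

  -- Decomposition along the generators

  π-∙-zeroˡ : ∀ {x y j} → toℕ (π x j) ≡ 0 → toℕ (π (x ∙ y) j) ≡ toℕ (π y j)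
  π-∙-zeroˡ {x} {y} {j} πx≡0 = ≡.trans (π-hom x y j)
    (≡.trans (≡.cong (λ a → (a + toℕ (π y j)) % m j) πx≡0) (m<n⇒m%n≡m (Fin.toℕ<n (π y j))))

  π-∙-zeroʳ : ∀ {x y j} → toℕ (π y j) ≡ 0 → toℕ (π (x ∙ y) j) ≡ toℕ (π x j)
  π-∙-zeroʳ {x} {y} {j} πy≡0 = ≡.trans (π-hom x y j)
    (≡.trans (≡.cong (λ a → (toℕ (π x j) + a) % m j) πy≡0)
      (≡.trans (≡.cong (_% m j) (ℕ.+-identityʳ _)) (m<n⇒m%n≡m (Fin.toℕ<n (π x j)))))

  π-∏-zero : ∀ n (f : Fin n → Carrier) j → (∀ k → toℕ (π (f k) j) ≡ 0) → toℕ (π (∏ n f) j) ≡ 0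
  π-∏-zero zero    f j f≡0 = π-ε j
  π-∏-zero (suc n) f j f≡0 = ≡.trans (π-∙-zeroˡ (f≡0 Fin.zero)) (π-∏-zero n (f ∘ Fin.suc) j (f≡0 ∘ Fin.suc))

  π-∏-single : ∀ n (f : Fin n → Carrier) j k₀ → (∀ k → k ≢ k₀ → toℕ (π (f k) j) ≡ 0) →
               toℕ (π (∏ n f) j) ≡ toℕ (π (f k₀) j)
  π-∏-single (suc n) f j Fin.zero     f≡0 =
    π-∙-zeroʳ (π-∏-zero n (f ∘ Fin.suc) j (λ k → f≡0 (Fin.suc k) (λ ())))
  π-∏-single (suc n) f j (Fin.suc k₀) f≡0 =
    ≡.trans (π-∙-zeroˡ (f≡0 Fin.zero (λ ())))
            (π-∏-single n (f ∘ Fin.suc) j k₀ (λ k k≢k₀ → f≡0 (Fin.suc k) (k≢k₀ ∘ Fin.suc-injective)))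

  π-ts-pow : ∀ i n → toℕ (π (ts i ^ n) i) ≡ n % m i
  π-ts-pow i zero    = ≡.trans (π-ε i) (≡.sym (m<n⇒m%n≡m (ℕ.>-nonZero⁻¹ (m i))))
  π-ts-pow i (suc n) = ≡.trans (π-hom (ts i) (ts i ^ n) i)
    (≡.trans (≡.cong₂ (λ a b → (a + b) % m i) (π-ts i) (π-ts-pow i n)) (≡.sym (%-distribˡ-+ 1 n (m i))))

  π-ts-pow-off : ∀ i n j → j ≢ i → toℕ (π (ts i ^ n) j) ≡ 0
  π-ts-pow-off i zero    j j≢i = π-ε j
  π-ts-pow-off i (suc n) j j≢i = ≡.trans (π-∙-zeroˡ (π-ts-off i j j≢i)) (π-ts-pow-off i n j j≢i)

  π-decomp : ∀ a i → π (decomp G S a) i ≡ a i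
  π-decomp a i = Fin.toℕ-injective (≡.trans
    (π-∏-single s _ i i (λ k k≢i → π-ts-pow-off k (toℕ (a k)) i (k≢i ∘ ≡.sym)))
    (≡.trans (π-ts-pow i (toℕ (a i))) (m<n⇒m%n≡m (Fin.toℕ<n (a i)))))

  decomp-exponents : ∀ {g a h} → H h → g ≈ decomp G S a ∙ h → ∀ i → a i ≡ π g i
  decomp-exponents {g} {a} {h} h∈H g≈ah i = ≡.trans (≡.sym (π-decomp a i)) (≡π-trans
    (≈⇒≡π (sym (identityʳ _))) (≡π-trans (≡π-∙ ≡π-refl (≡π-sym (∈H⇒≡πε h∈H))) (≈⇒≡π (sym g≈ah))) i)

  decomposition : ∀ g → ∃[ a ] ∃[ h ] (H h × g ≈ decomp G S a ∙ h)
  decomposition g = π g , decomp G S (π g) ⁻¹ ∙ g , ≡π⇒∼ (π-decomp (π g)) , sym (\\-leftDividesˡ _ g)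

  part-i : Part-i G S
  part-i g = decomposition g , unique , transfer-decomp
    where
    unique : ∀ a h a′ h′ → H h → H h′ → g ≈ decomp G S a ∙ h → g ≈ decomp G S a′ ∙ h′
           → (∀ i → a i ≡ a′ i) × h ≈ h′
    unique a h a′ h′ h∈H h′∈H g≈ah g≈a′h′ = a≡a′ , ∙-cancelˡ (decomp G S a) _ _
      (trans (sym g≈ah) (trans g≈a′h′ (∙-congʳ (∏-cong s (λ i → pow-≡ (ts i) (≡.cong toℕ (≡.sym (a≡a′ i))))))))
      where
      a≡a′ : ∀ i → a i ≡ a′ i
      a≡a′ i = ≡.trans (decomp-exponents {a = a} h∈H g≈ah i) (≡.sym (decomp-exponents {a = a′} h′∈H g≈a′h′ i))
    transfer-decomp : ∀ a h → H h → g ≈ decomp G S a ∙ h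
                    → Tr G S g ≈ ∏ s (λ i → Tr G S (ts i) ^ toℕ (a i)) ∙ Tr G S h
    transfer-decomp a h _ g≈ah = begin
      Tr G S g                                           ≈⟨ transfer-cong T g≈ah ⟩
      Tr G S (decomp G S a ∙ h)                          ≈⟨ transfer-∙ T _ _ ⟩
      Tr G S (decomp G S a) ∙ Tr G S h                   ≈⟨ ∙-congʳ (transfer-∏ T s _) ⟩
      ∏ s (λ i → Tr G S (ts i ^ toℕ (a i))) ∙ Tr G S h   ≈⟨ ∙-congʳ (∏-cong s (λ i → transfer-pow T (ts i) (toℕ (a i)))) ⟩
      ∏ s (λ i → Tr G S (ts i) ^ toℕ (a i)) ∙ Tr G S h   ∎

  -- Products of representatives

  ∏-square-≡πε : ∀ e (r : Fin e → Carrier) (ι : Permutation e e) → (∀ j → r (ι ⟨$⟩ʳ j) ≡π r j ⁻¹) →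
                 ∏ e r ∙ ∏ e r ≡π ε
  ∏-square-≡πε e r ι r∘ι≡r⁻¹ =
    ≡π-trans (≡π-∙ ≡π-refl (∏-permute-≡π r (λ _ → tt) ι))
      (≡π-trans (≡π-∙ ≡π-refl (∏-cong-≡π e r∘ι≡r⁻¹))
        (≡π-trans (≡π-sym (∏-distrib-≡π e r (λ j → r j ⁻¹) (λ _ → tt) (λ _ → tt)))
          (≈⇒≡π (∏-≈ε e _ (λ j → inverseʳ (r j))))))

  module TransversalIndex {q} {K : Pred Carrier q} {e} (R : Transversal G K H e) where
    open Transversal R public

    index : ∀ x → K x → Fin e
    index x x∈K = proj₁ (covers x x∈K)

    rep-index : ∀ x x∈K → rep (index x x∈K) ≡π x
    rep-index x x∈K = ∼⇒≡π (proj₂ (covers x x∈K))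

    rep-injective : ∀ {j j′} → rep j ≡π rep j′ → j ≡ j′
    rep-injective e = distinct _ _ (≡π⇒∼ e)

  transversal-square : ∀ {q} {K : Pred Carrier q} → (∀ {x} → K x → K (x ⁻¹)) →
    ∀ {e} (R : Transversal G K H e) → ∏ e (Transversal.rep R) ∙ ∏ e (Transversal.rep R) ≡π ε
  transversal-square K-⁻¹ {e} R = ∏-square-≡πε e rep inversion (λ j → rep-index _ _)
    where
    open TransversalIndex R
    inverse-rep : Fin e → Fin e
    inverse-rep j = index (rep j ⁻¹) (K-⁻¹ (rep∈ j))
    inverse-rep-involutive : ∀ j → inverse-rep (inverse-rep j) ≡ j
    inverse-rep-involutive j = rep-injective
      (≡π-trans (rep-index _ _) (≡π-trans (≡π-⁻¹ (rep-index _ _)) (≈⇒≡π (⁻¹-involutive _))))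
    inversion : Permutation e e
    inversion = permutation inverse-rep inverse-rep inverse-rep-involutive inverse-rep-involutive

  comm-∈H-coset : ∀ {h a a′} → H h → a ∼ a′ → [ h , a′ ] ≈ [ h , a ]
  comm-∈H-coset {h} {a} {a′} h∈H a∼a′ = begin
    [ h , a′ ]                    ≈⟨ comm-congʳ h (\\-leftDividesˡ a a′) ⟨
    [ h , a ∙ (a ⁻¹ ∙ a′) ]       ≈⟨ comm-bilinearʳ _ _ _ ⟩
    [ h , a ] ∙ [ h , a ⁻¹ ∙ a′ ] ≈⟨ ∙-congˡ (commute⇒comm≈ε (H-abelian h∈H a∼a′)) ⟩
    [ h , a ] ∙ ε                 ≈⟨ identityʳ _ ⟩
    [ h , a ]                     ∎

  comm-∈H-square : ∀ {h a} → H h → a ∙ a ≡π ε → [ h , a ] ∙ [ h , a ] ≈ ε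
  comm-∈H-square h∈H a²≡πε = trans (sym (comm-bilinearʳ _ _ _)) (commute⇒comm≈ε (H-abelian h∈H (≡πε⇒∈H a²≡πε)))

  comm-∈H-representatives : ∀ {h α} → H h → α ∙ α ≡π ε → ∀ α̂ α̂′ → α ∼ α̂ → α ∼ α̂′ →
    [ h , α̂ ] ≈ [ h , α̂′ ] × ([ h , α̂ ] ∙ [ h , α̂ ]) ≈ ε
  comm-∈H-representatives h∈H α²≡πε α̂ α̂′ α∼α̂ α∼α̂′ =
      trans (comm-∈H-coset h∈H α∼α̂) (sym (comm-∈H-coset h∈H α∼α̂′))
    , comm-∈H-square h∈H (≡π-trans (≡π-∙ (≡π-sym (∼⇒≡π α∼α̂)) (≡π-sym (∼⇒≡π α∼α̂))) α²≡πε)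

  α : Carrier
  α = ∏ d t

  α²≡πε : α ∙ α ≡π ε
  α²≡πε = transversal-square (λ _ → tt) record
    { rep = t ; rep∈ = λ _ → tt ; distinct = LeftTransversal.distinct T ; covers = λ x _ → idx x , idx-spec x }

  transfer-∈H : ∀ {h} → H h → Tr G S h ≈ h ^ d ∙ [ h , α ]
  transfer-∈H {h} h∈H = begin
    ∏ d (factor T h)                         ≈⟨ ∏-cong d (λ i → trans (∙-congʳ (∙-congʳ (⁻¹-cong (t-cong T (idx-h∙t i))))) (conjugate h (t i))) ⟩
    ∏ d (λ i → h ∙ [ h , t i ])              ≈⟨ ∏-distrib-central d _ _ (λ i → comm-central _ _) ⟩
    ∏ d (λ _ → h) ∙ ∏ d (λ i → [ h , t i ])  ≈⟨ ∙-cong (sym (∏-const d h)) (comm-∏ʳ h d t) ⟨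
    h ^ d ∙ [ h , α ]                        ∎
    where
    idx-h∙t : ∀ i → idx (h ∙ t i) ≡ i
    idx-h∙t i = ≡.trans (idx-cong T (≡π⇒∼ (≡π-trans (≡π-∙ (∈H⇒≡πε h∈H) ≡π-refl) (≈⇒≡π (identityˡ _))))) (idx-t T i)

  part-ii-H : ∀ h → H h → ∀ α̂ α̂′ → α ∼ α̂ → α ∼ α̂′ →
    Tr G S h ≈ h ^ d ∙ [ h , α̂ ] × [ h , α̂ ] ≈ [ h , α̂′ ] × ([ h , α̂ ] ∙ [ h , α̂ ]) ≈ ε
  part-ii-H h h∈H α̂ α̂′ α∼α̂ α∼α̂′ =
    trans (transfer-∈H h∈H) (∙-congˡ (sym (comm-∈H-coset h∈H α∼α̂))) ,
    comm-∈H-representatives h∈H α²≡πε α̂ α̂′ α∼α̂ α∼α̂′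

  -- Transfer of a generator

  ts-pow-mod : ∀ i a b → a % m i ≡ b % m i → ts i ^ a ≡π ts i ^ b
  ts-pow-mod i a b a≡b j with j Fin.≟ i
  ... | yes ≡.refl = Fin.toℕ-injective (≡.trans (π-ts-pow i a) (≡.trans a≡b (≡.sym (π-ts-pow i b))))
  ... | no j≢i     = Fin.toℕ-injective (≡.trans (π-ts-pow-off i a j j≢i) (≡.sym (π-ts-pow-off i b j j≢i)))

  ts-pow-injective : ∀ i {a b} → ts i ^ a ≡π ts i ^ b → a < m i → b < m i → a ≡ b
  ts-pow-injective i {a} {b} e a<m b<m =
    ≡.trans (≡.sym (m<n⇒m%n≡m a<m)) (≡.trans (≡.sym (π-ts-pow i a))
      (≡.trans (≡.cong toℕ (e i)) (≡.trans (π-ts-pow i b) (m<n⇒m%n≡m b<m))))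

  ts-pow-m≡πε : ∀ i → ts i ^ m i ≡π ε
  ts-pow-m≡πε i = ts-pow-mod i (m i) 0 (≡.trans (n%n≡0 (m i)) (≡.sym (m<n⇒m%n≡m (ℕ.>-nonZero⁻¹ (m i)))))

  ts-pow-m-∈H : ∀ i → H (ts i ^ m i)
  ts-pow-m-∈H i = ≡πε⇒∈H (ts-pow-m≡πε i)

  module AdaptedTransversal (i : Fin s) {K : Pred Carrier p} (K-complement : IsComplement G S i K)
                            {e : ℕ} (R : Transversal G K H e) where
    open TransversalIndex R
    open IsSubgroup (proj₁ K-complement) using () renaming (∙∈ to K-∙; ⁻¹∈ to K-⁻¹)

    private
      u : Carrier
      u = ts i
      k : ℕ
      k = m i
      meets-trivially : ∀ g n → K g → H ((u ^ n) ⁻¹ ∙ g) → H g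
      meets-trivially = proj₁ (proj₂ (proj₂ K-complement))
      spans : ∀ g → ∃[ y ] ∃[ n ] (K y × H ((y ∙ u ^ n) ⁻¹ ∙ g))
      spans = proj₂ (proj₂ (proj₂ K-complement))

    αᵢ : Carrier
    αᵢ = ∏ e rep

    αᵢ²≡πε : αᵢ ∙ αᵢ ≡π ε
    αᵢ²≡πε = transversal-square K-⁻¹ R

    u-pow-inverse : ∀ {a} → a < k → u ^ (k ∸ a) ≡π (u ^ a) ⁻¹
    u-pow-inverse {a} a<k = ≡π-inverse-unique (≡π-trans (≈⇒≡π (sym (pow-+ u a (k ∸ a))))
      (≡π-trans (≈⇒≡π (pow-≡ u (ℕ.m+[n∸m]≡n (ℕ.<⇒≤ a<k)))) (ts-pow-m≡πε i)))

    rep∙pow-injective : ∀ {j j′ a a′} → rep j ∙ u ^ a ≡π rep j′ ∙ u ^ a′ → a < k → a′ < k → j ≡ j′ × a ≡ a′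
    rep∙pow-injective {j} {j′} {a} {a′} e a<k a′<k = j≡j′ , a≡a′
      where
      quotient-is-power : u ^ (a + (k ∸ a′)) ≡π rep j ⁻¹ ∙ rep j′
      quotient-is-power = ≡π-trans (≈⇒≡π (pow-+ u a (k ∸ a′)))
        (≡π-trans (≡π-∙ ≡π-refl (u-pow-inverse a′<k)) (≡π-sym (≡π-transpose e)))
      j≡j′ : j ≡ j′
      j≡j′ = rep-injective (∼⇒≡π (meets-trivially _ (a + (k ∸ a′))
        (K-∙ (K-⁻¹ (rep∈ j)) (rep∈ j′)) (≡π⇒∼ quotient-is-power)))
      a≡a′ : a ≡ a′
      a≡a′ = ts-pow-injective i (≡π-cancelˡ (≡.subst (λ j″ → rep j ∙ u ^ a ≡π rep j″ ∙ u ^ a′) (≡.sym j≡j′) e)) a<k a′<k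

    reduce : ℕ → Fin k
    reduce n = fromℕ< (m%n<n n k)

    pow-reduce : ∀ n → u ^ toℕ (reduce n) ≡π u ^ n
    pow-reduce n = ts-pow-mod i _ n (≡.trans (≡.cong (_% k) (Fin.toℕ-fromℕ< (m%n<n n k))) (m%n%n≡m%n n k))

    t′ : Fin (e * k) → Carrier
    t′ x = uncurry (λ j a → rep j ∙ u ^ toℕ a) (remQuot k x)

    t′-combine : ∀ j a → t′ (combine j a) ≈ rep j ∙ u ^ toℕ a
    t′-combine j a = reflexive (≡.cong (uncurry (λ j a → rep j ∙ u ^ toℕ a)) (Fin.remQuot-combine j a))

    idx′ : Carrier → Fin (e * k)
    idx′ x with (y , n , y∈K , _) ← spans x = combine (index y y∈K) (reduce n)

    idx′-spec : ∀ x → t′ (idx′ x) ∼ x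
    idx′-spec x with (y , n , y∈K , y∙uⁿ∼x) ← spans x =
      ∼-trans (≡π⇒∼ (≡π-trans (≈⇒≡π (t′-combine _ _)) (≡π-∙ (rep-index y y∈K) (pow-reduce n)))) y∙uⁿ∼x

    distinct′ : ∀ x y → t′ x ∼ t′ y → x ≡ y
    distinct′ x y t′x∼t′y = ≡.trans (≡.sym (Fin.combine-remQuot {e} k x))
      (≡.trans (≡.cong₂ combine (proj₁ same) (Fin.toℕ-injective (proj₂ same))) (Fin.combine-remQuot {e} k y))
      where same = rep∙pow-injective (∼⇒≡π t′x∼t′y) (Fin.toℕ<n (proj₂ (remQuot {e} k x))) (Fin.toℕ<n (proj₂ (remQuot {e} k y)))

    T′ : LeftTransversal G H (e * k)
    T′ = record { t = t′ ; distinct = distinct′ ; idx = idx′ ; idx-spec = idx′-spec }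

    idx′-next : ∀ j a → idx′ (u ∙ t′ (combine j a)) ≡ combine j (reduce (suc (toℕ a)))
    idx′-next j a = ≡.trans (idx-cong T′ (≡π⇒∼ shifted)) (idx-t T′ _)
      where
      r = rep j
      shifted : u ∙ t′ (combine j a) ≡π t′ (combine j (reduce (suc (toℕ a))))
      shifted = ≡π-trans (≡π-∙ ≡π-refl (≈⇒≡π (t′-combine j a)))
        (≡π-trans (≡π-comm u (r ∙ u ^ toℕ a)) (≡π-trans (≈⇒≡π (assoc r _ u))
          (≡π-trans (≡π-∙ ≡π-refl (≡π-comm _ u))
            (≡π-sym (≡π-trans (≈⇒≡π (t′-combine _ _)) (≡π-∙ ≡π-refl (pow-reduce (suc (toℕ a)))))))))

    factor-combine : ∀ j a → factor T′ u (combine j a) ≈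
      (((u ^ (suc (toℕ a) % k)) ⁻¹ ∙ rep j ⁻¹) ∙ u) ∙ (rep j ∙ u ^ toℕ a)
    factor-combine j a = ∙-cong (∙-congʳ next⁻¹) (t′-combine j a)
      where
      next⁻¹ : t′ (idx′ (u ∙ t′ (combine j a))) ⁻¹ ≈ (u ^ (suc (toℕ a) % k)) ⁻¹ ∙ rep j ⁻¹
      next⁻¹ = begin
        t′ (idx′ (u ∙ t′ (combine j a))) ⁻¹              ≈⟨ ⁻¹-cong (t-cong T′ (idx′-next j a)) ⟩
        t′ (combine j (reduce (suc (toℕ a)))) ⁻¹         ≈⟨ ⁻¹-cong (t′-combine _ _) ⟩
        (rep j ∙ u ^ toℕ (reduce (suc (toℕ a)))) ⁻¹      ≈⟨ ⁻¹-anti-homo-∙ _ _ ⟩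
        (u ^ toℕ (reduce (suc (toℕ a)))) ⁻¹ ∙ rep j ⁻¹   ≈⟨ ∙-congʳ (⁻¹-cong (pow-≡ u (Fin.toℕ-fromℕ< (m%n<n (suc (toℕ a)) k)))) ⟩
        (u ^ (suc (toℕ a) % k)) ⁻¹ ∙ rep j ⁻¹            ∎

    factor-inner : ∀ j a → suc (toℕ a) ≢ k → factor T′ u (combine j a) ≈ [ u , rep j ]
    factor-inner j a a+1≢k = begin
      factor T′ u (combine j a)                                  ≈⟨ factor-combine j a ⟩
      (((u ^ (suc (toℕ a) % k)) ⁻¹ ∙ r ⁻¹) ∙ u) ∙ (r ∙ y)        ≈⟨ ∙-congʳ (∙-congʳ (∙-congʳ (⁻¹-cong (pow-≡ u (m<n⇒m%n≡m a+1<k))))) ⟩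
      (((u ∙ y) ⁻¹ ∙ r ⁻¹) ∙ u) ∙ (r ∙ y)                        ≈⟨ assoc _ _ _ ⟩
      ((u ∙ y) ⁻¹ ∙ r ⁻¹) ∙ (u ∙ (r ∙ y))                        ≈⟨ ∙-congˡ u∙r∙y ⟩
      ((u ∙ y) ⁻¹ ∙ r ⁻¹) ∙ ((r ∙ (u ∙ y)) ∙ [ u , r ])          ≈⟨ assoc _ _ _ ⟩
      (u ∙ y) ⁻¹ ∙ (r ⁻¹ ∙ ((r ∙ (u ∙ y)) ∙ [ u , r ]))          ≈⟨ ∙-congˡ (∙-congˡ (assoc _ _ _)) ⟩
      (u ∙ y) ⁻¹ ∙ (r ⁻¹ ∙ (r ∙ ((u ∙ y) ∙ [ u , r ])))          ≈⟨ ∙-congˡ (\\-leftDividesʳ _ _) ⟩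
      (u ∙ y) ⁻¹ ∙ ((u ∙ y) ∙ [ u , r ])                         ≈⟨ \\-leftDividesʳ _ _ ⟩
      [ u , r ]                                                  ∎
      where
      r = rep j
      y = u ^ toℕ a
      a+1<k : suc (toℕ a) < k
      a+1<k = ℕ.≤∧≢⇒< (Fin.toℕ<n a) a+1≢k
      u∙r∙y : u ∙ (r ∙ y) ≈ (r ∙ (u ∙ y)) ∙ [ u , r ]
      u∙r∙y = begin
        u ∙ (r ∙ y)                ≈⟨ assoc _ _ _ ⟨
        (u ∙ r) ∙ y                ≈⟨ ∙-congʳ (∙-swap u r) ⟩
        ((r ∙ u) ∙ [ u , r ]) ∙ y  ≈⟨ central-slide (comm-central u r) _ _ ⟩
        ((r ∙ u) ∙ y) ∙ [ u , r ]  ≈⟨ ∙-congʳ (assoc _ _ _) ⟩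
        (r ∙ (u ∙ y)) ∙ [ u , r ]  ∎

    factor-last : ∀ j a → suc (toℕ a) ≡ k → factor T′ u (combine j a) ≈ u ^ k ∙ [ u , rep j ]
    factor-last j a a+1≡k = begin
      factor T′ u (combine j a)                      ≈⟨ factor-combine j a ⟩
      (((u ^ (suc (toℕ a) % k)) ⁻¹ ∙ r ⁻¹) ∙ u) ∙ (r ∙ y)  ≈⟨ ∙-congʳ (∙-congʳ (∙-congʳ (trans (⁻¹-cong (pow-≡ u wraps)) ε⁻¹≈ε))) ⟩
      ((ε ∙ r ⁻¹) ∙ u) ∙ (r ∙ y)                     ≈⟨ ∙-congʳ (∙-congʳ (identityˡ _)) ⟩
      (r ⁻¹ ∙ u) ∙ (r ∙ y)                           ≈⟨ assoc _ _ _ ⟨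
      ((r ⁻¹ ∙ u) ∙ r) ∙ y                           ≈⟨ ∙-congʳ (conjugate u r) ⟩
      (u ∙ [ u , r ]) ∙ y                            ≈⟨ central-slide (comm-central u r) _ _ ⟩
      (u ∙ y) ∙ [ u , r ]                            ≈⟨ ∙-congʳ (pow-≡ u a+1≡k) ⟩
      u ^ k ∙ [ u , r ]                              ∎
      where
      r = rep j
      y = u ^ toℕ a
      wraps : suc (toℕ a) % k ≡ 0
      wraps = ≡.trans (≡.cong (_% k) a+1≡k) (n%n≡0 k)

    transfer-adapted : transfer G T′ u ≈ u ^ (e * k) ∙ [ u ^ k , αᵢ ]
    transfer-adapted = begin
      ∏ (e * k) (factor T′ u)                              ≈⟨ ∏-combine e k _ ⟩
      ∏ e (λ j → ∏ k (λ a → factor T′ u (combine j a)))   ≈⟨ ∏-cong e (λ j → ∏-central-except-last k _ (u ^ k) [ u , rep j ]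
                                                              (comm-central _ _) (ℕ.>-nonZero⁻¹ k) (factor-last j) (factor-inner j)) ⟩
      ∏ e (λ j → u ^ k ∙ [ u , rep j ] ^ k)                ≈⟨ ∏-distrib-central e _ _ (λ j → Central-pow k (comm-central _ _)) ⟩
      ∏ e (λ _ → u ^ k) ∙ ∏ e (λ j → [ u , rep j ] ^ k)    ≈⟨ ∙-cong (sym (∏-const e _)) (∏-cong e (λ j → comm-powˡ _ _ k)) ⟨
      (u ^ k) ^ e ∙ ∏ e (λ j → [ u ^ k , rep j ])          ≈⟨ ∙-cong (pow-* u k e) (comm-∏ʳ _ e rep) ⟨
      u ^ (e * k) ∙ [ u ^ k , αᵢ ]                         ∎

    transfer-ts : Tr G S u ≈ u ^ d ∙ [ u ^ k , αᵢ ]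
    transfer-ts = trans (transfer-independent T T′ u)
      (trans transfer-adapted (∙-congʳ (pow-≡ u (≡.sym (index-unique T T′)))))

    part-ii-ts : ∀ α̂ α̂′ → αᵢ ∼ α̂ → αᵢ ∼ α̂′ →
        Tr G S u ≈ u ^ d ∙ [ u ^ k , α̂ ] × [ u ^ k , α̂ ] ≈ [ u ^ k , α̂′ ]
      × ([ u ^ k , α̂ ] ∙ [ u ^ k , α̂ ]) ≈ ε
    part-ii-ts α̂ α̂′ αᵢ∼α̂ αᵢ∼α̂′ =
      trans transfer-ts (∙-congˡ (sym (comm-∈H-coset (ts-pow-m-∈H i) αᵢ∼α̂))) ,
      comm-∈H-representatives (ts-pow-m-∈H i) αᵢ²≡πε α̂ α̂′ αᵢ∼α̂ αᵢ∼α̂′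

  coordinate-kernel : Fin s → Pred Carrier p
  coordinate-kernel i x = Lift p (toℕ (π x i) ≡ 0)

  π-⁻¹-zero : ∀ {x i} → toℕ (π x i) ≡ 0 → toℕ (π (x ⁻¹) i) ≡ 0
  π-⁻¹-zero {x} {i} πx≡0 = ≡.trans (≡.sym (π-∙-zeroʳ πx≡0)) (≡.trans (≡.cong toℕ (≈⇒≡π (inverseˡ x) i)) (π-ε i))

  coordinate-kernel-subgroup : ∀ i → IsSubgroup G (coordinate-kernel i)
  coordinate-kernel-subgroup i = record
    { resp = λ x≈y (lift πx≡0) → lift (≡.trans (≡.cong toℕ (≡.sym (≈⇒≡π x≈y i))) πx≡0)
    ; ε∈  = lift (π-ε i)
    ; ∙∈  = λ (lift πx≡0) (lift πy≡0) → lift (≡.trans (π-∙-zeroˡ πx≡0) πy≡0)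
    ; ⁻¹∈ = λ (lift πx≡0) → lift (π-⁻¹-zero πx≡0) }

  coordinate-kernel-complement : ∀ i → IsComplement G S i (coordinate-kernel i)
  coordinate-kernel-complement i =
    coordinate-kernel-subgroup i , (λ {x} x∈H → lift (π-ker x x∈H i)) , meets-trivially , spans
    where
    k = m i
    meets-trivially : ∀ g n → coordinate-kernel i g → (ts i ^ n) ∼ g → H g
    meets-trivially g n (lift πg≡0) uⁿ∼g = π-ker⁻¹ g πg≡0′
      where
      πg≡0′ : ∀ j → toℕ (π g j) ≡ 0
      πg≡0′ j with j Fin.≟ i
      ... | yes ≡.refl = πg≡0
      ... | no j≢i     = ≡.trans (≡.cong toℕ (≡.sym (∼⇒≡π uⁿ∼g j))) (π-ts-pow-off i n j j≢i)
    spans : ∀ g → ∃[ y ] ∃[ n ] (coordinate-kernel i y × (y ∙ ts i ^ n) ∼ g)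
    spans g = g ∙ ts i ^ (k ∸ n) , n , lift πy≡0 , ≡π⇒∼ y∙uⁿ≡πg
      where
      n = toℕ (π g i)
      n<k = Fin.toℕ<n (π g i)
      πy≡0 : toℕ (π (g ∙ ts i ^ (k ∸ n)) i) ≡ 0
      πy≡0 = ≡.trans (π-hom _ _ i)
        (≡.trans (≡.cong (λ z → (z + toℕ (π (ts i ^ (k ∸ n)) i)) % k) (≡.sym (m<n⇒m%n≡m n<k)))
        (≡.trans (≡.cong (λ z → (n % k + z) % k) (π-ts-pow i (k ∸ n)))
        (≡.trans (≡.sym (%-distribˡ-+ n (k ∸ n) k))
        (≡.trans (≡.cong (_% k) (ℕ.m+[n∸m]≡n (ℕ.<⇒≤ n<k))) (n%n≡0 k)))))
      y∙uⁿ≡πg : (g ∙ ts i ^ (k ∸ n)) ∙ ts i ^ n ≡π g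
      y∙uⁿ≡πg = ≡π-trans (≈⇒≡π (trans (assoc _ _ _) (∙-congˡ (trans (sym (pow-+ (ts i) (k ∸ n) n))
                  (pow-≡ (ts i) (ℕ.m∸n+n≡m (ℕ.<⇒≤ n<k)))))))
                (≡π-trans (≡π-∙ ≡π-refl (ts-pow-m≡πε i)) (≈⇒≡π (identityʳ g)))

  coordinate-kernel-transversal : ∀ i → ∃[ e ] Transversal G (coordinate-kernel i) H e
  coordinate-kernel-transversal i = length reps , record
    { rep = t ∘ lookup reps
    ; rep∈ = λ j → lift (proj₂ (∈-filter⁻ in-kernel? {xs = allFin d} (∈-lookup j)))
    ; distinct = λ j j′ h → lookup-injective reps-unique j j′ (LeftTransversal.distinct T _ _ h)
    ; covers = covers }
    where
    in-kernel? : (j : Fin d) → Dec (toℕ (π (t j) i) ≡ 0)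
    in-kernel? j = toℕ (π (t j) i) ℕ.≟ 0
    reps : List (Fin d)
    reps = filter in-kernel? (allFin d)
    reps-unique : Unique reps
    reps-unique = Unique.filter⁺ in-kernel? (Unique.allFin⁺ d)
    covers : ∀ x → coordinate-kernel i x → ∃[ j ] (t (lookup reps j) ∼ x)
    covers x (lift πx≡0) = Any.index idx∈reps , ≡.subst (λ z → t z ∼ x) (lookup-index idx∈reps) (idx-spec x)
      where
      idx∈reps : idx x ∈ reps
      idx∈reps = ∈-filter⁺ in-kernel? (∈-allFin (idx x)) (≡.trans (≡.cong toℕ (∼⇒≡π (idx-spec x) i)) πx≡0)

  -- The exponent d on commutators

  DTorsion : Carrier → Set ℓ
  DTorsion z = z ^ d ≈ ε

  DTorsion-resp : ∀ {a b} → a ≈ b → DTorsion a → DTorsion b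
  DTorsion-resp a≈b aᵈ≈ε = trans (pow-cong d (sym a≈b)) aᵈ≈ε

  DTorsion-∙ : ∀ {a b} → Central G b → DTorsion a → DTorsion b → DTorsion (a ∙ b)
  DTorsion-∙ cb aᵈ≈ε bᵈ≈ε = trans (pow-∙-central d cb) (trans (∙-cong aᵈ≈ε bᵈ≈ε) (identityˡ ε))

  DTorsion-pow : ∀ {z} n → DTorsion z → DTorsion (z ^ n)
  DTorsion-pow {z} n zᵈ≈ε = trans (pow-comm z n d) (pow-≈ε n zᵈ≈ε)

  DTorsion-∏ : ∀ n (f : Fin n → Carrier) → (∀ i → Central G (f i)) → (∀ i → DTorsion (f i)) → DTorsion (∏ n f)
  DTorsion-∏ zero    f cf tf = ε-pow d
  DTorsion-∏ (suc n) f cf tf =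
    DTorsion-∙ (Central-∏ n (cf ∘ Fin.suc)) (tf Fin.zero) (DTorsion-∏ n _ (cf ∘ Fin.suc) (tf ∘ Fin.suc))

  pow-one-∈H : ∀ {h} → H h → H (h ^ 1)
  pow-one-∈H h∈H = H-resp (sym (identityʳ _)) h∈H

  comm-torsion : ∀ {x y} a b → H (x ^ a) → H (y ^ b) → b * a ∣ d → DTorsion [ x , y ]
  comm-torsion {x} {y} a b xᵃ∈H yᵇ∈H ba∣d = pow-∣-≈ε ba∣d (begin
    [ x , y ] ^ (b * a)   ≈⟨ pow-* _ a b ⟩
    ([ x , y ] ^ a) ^ b   ≈⟨ pow-cong b (comm-powˡ x y a) ⟨
    [ x ^ a , y ] ^ b     ≈⟨ comm-powʳ _ _ b ⟨
    [ x ^ a , y ^ b ]     ≈⟨ commute⇒comm≈ε (H-abelian xᵃ∈H yᵇ∈H) ⟩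
    ε                     ∎)

  m∣d : ∀ j → m j ∣ d
  m∣d j = ≡.subst (m j ∣_) m-prod (prodℕ-∣ s m j)

  comm-ts-ts-torsion : ∀ j k → DTorsion [ ts j , ts k ]
  comm-ts-ts-torsion j k with j Fin.≟ k
  ... | yes ≡.refl = DTorsion-resp (sym (comm-self _)) (ε-pow d)
  ... | no j≢k     = comm-torsion (m j) (m k) (ts-pow-m-∈H j) (ts-pow-m-∈H k)
                       (≡.subst (m k * m j ∣_) m-prod (prodℕ-*-∣ s m k j (j≢k ∘ ≡.sym)))

  comm-ts-H-torsion : ∀ j {h} → H h → DTorsion [ ts j , h ]
  comm-ts-H-torsion j h∈H = comm-torsion (m j) 1 (ts-pow-m-∈H j) (pow-one-∈H h∈H)
    (≡.subst (_∣ d) (≡.sym (ℕ.*-identityˡ (m j))) (m∣d j))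

  comm-H-ts-torsion : ∀ {h} → H h → ∀ k → DTorsion [ h , ts k ]
  comm-H-ts-torsion h∈H k = comm-torsion 1 (m k) (pow-one-∈H h∈H) (ts-pow-m-∈H k)
    (≡.subst (_∣ d) (≡.sym (ℕ.*-identityʳ (m k))) (m∣d k))

  comm-H-H-torsion : ∀ {h h′} → H h → H h′ → DTorsion [ h , h′ ]
  comm-H-H-torsion h∈H h′∈H = comm-torsion 1 1 (pow-one-∈H h∈H) (pow-one-∈H h′∈H) (1∣ d)

  comm-torsionʳ : ∀ x → (∀ k → DTorsion [ x , ts k ]) → (∀ {h} → H h → DTorsion [ x , h ]) →
                  ∀ y → DTorsion [ x , y ]
  comm-torsionʳ x gens hs y with (b , h , h∈H , y≈bh) ← decomposition y =
    DTorsion-resp (sym expand)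
      (DTorsion-∙ (comm-central _ _)
        (DTorsion-∏ s _ (λ k → Central-pow (toℕ (b k)) (comm-central _ _)) (λ k → DTorsion-pow (toℕ (b k)) (gens k)))
        (hs h∈H))
    where
    expand : [ x , y ] ≈ ∏ s (λ k → [ x , ts k ] ^ toℕ (b k)) ∙ [ x , h ]
    expand = trans (comm-congʳ x y≈bh) (trans (comm-bilinearʳ _ _ _)
      (∙-congʳ (trans (comm-∏ʳ x s _) (∏-cong s (λ k → comm-powʳ x (ts k) (toℕ (b k)))))))

  comm-torsionˡ : ∀ y → (∀ k → DTorsion [ ts k , y ]) → (∀ {h} → H h → DTorsion [ h , y ]) →
                  ∀ x → DTorsion [ x , y ]
  comm-torsionˡ y gens hs x with (a , h , h∈H , x≈ah) ← decomposition x =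
    DTorsion-resp (sym expand)
      (DTorsion-∙ (comm-central _ _)
        (DTorsion-∏ s _ (λ k → Central-pow (toℕ (a k)) (comm-central _ _)) (λ k → DTorsion-pow (toℕ (a k)) (gens k)))
        (hs h∈H))
    where
    expand : [ x , y ] ≈ ∏ s (λ k → [ ts k , y ] ^ toℕ (a k)) ∙ [ h , y ]
    expand = trans (comm-congˡ y x≈ah) (trans (comm-bilinearˡ _ _ _)
      (∙-congʳ (trans (comm-∏ˡ y s _) (∏-cong s (λ k → comm-powˡ (ts k) y (toℕ (a k)))))))

  comm-pow-d≈ε : ∀ x y → [ x , y ] ^ d ≈ ε
  comm-pow-d≈ε x y = comm-torsionˡ y
    (λ j → comm-torsionʳ (ts j) (comm-ts-ts-torsion j) (comm-ts-H-torsion j) y)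
    (λ h∈H → comm-torsionʳ _ (comm-H-ts-torsion h∈H) (comm-H-H-torsion h∈H) y)
    x

  moreover : Moreover G S
  moreover = comm-pow-d≈ε , λ g y → comm≈ε⇒commute (trans (comm-powˡ g y d) (comm-pow-d≈ε g y))

  -- The defect Tr(g) g⁻ᵈ

  TrUpToCentralInvolution : Carrier → Set (c ⊔ ℓ)
  TrUpToCentralInvolution g = ∃[ φ ] (Tr G S g ≈ g ^ d ∙ φ × Central G φ × φ ∙ φ ≈ ε)

  TrUpToCentralInvolution-resp : ∀ {x y} → x ≈ y → TrUpToCentralInvolution x → TrUpToCentralInvolution y
  TrUpToCentralInvolution-resp x≈y (φ , Tr≈ , cφ , φ²≈ε) =
    φ , trans (transfer-cong T (sym x≈y)) (trans Tr≈ (∙-congʳ (pow-cong d x≈y))) , cφ , φ²≈ε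

  TrUpToCentralInvolution-ε : TrUpToCentralInvolution ε
  TrUpToCentralInvolution-ε = ε , trans (transfer-ε T) (sym (trans (identityʳ _) (ε-pow d))) , Central-ε , identityʳ ε

  TrUpToCentralInvolution-∙ : ∀ {x y} → TrUpToCentralInvolution x → TrUpToCentralInvolution y →
                              TrUpToCentralInvolution (x ∙ y)
  TrUpToCentralInvolution-∙ {x} {y} (φx , Trx≈ , cφx , φx²≈ε) (φy , Try≈ , cφy , φy²≈ε) =
    z ∙ (φx ∙ φy) , Trxy≈ , Central-∙ cz (Central-∙ cφx cφy) ,
    involution-∙-central (Central-∙ cφx cφy) z²≈ε (involution-∙-central cφy φx²≈ε φy²≈ε)
    where
    z = [ y , x ] ^ (d C 2)
    cz : Central G z
    cz = Central-pow (d C 2) (comm-central _ _)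
    z²≈ε : z ∙ z ≈ ε
    z²≈ε = begin
      z ∙ z                        ≈⟨ pow-+ _ (d C 2) (d C 2) ⟨
      [ y , x ] ^ (d C 2 + d C 2)  ≈⟨ pow-≡ _ (C2+C2 d) ⟩
      [ y , x ] ^ ((d ∸ 1) * d)    ≈⟨ pow-∣-≈ε (n∣m*n (d ∸ 1)) (comm-pow-d≈ε y x) ⟩
      ε                            ∎
    xᵈyᵈ≈ : x ^ d ∙ y ^ d ≈ (x ∙ y) ^ d ∙ z
    xᵈyᵈ≈ = begin
      x ^ d ∙ y ^ d               ≈⟨ identityʳ _ ⟨
      (x ^ d ∙ y ^ d) ∙ ε         ≈⟨ ∙-congˡ z²≈ε ⟨
      (x ^ d ∙ y ^ d) ∙ (z ∙ z)   ≈⟨ assoc _ _ _ ⟨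
      ((x ^ d ∙ y ^ d) ∙ z) ∙ z   ≈⟨ ∙-congʳ (pow-∙ x y d) ⟨
      (x ∙ y) ^ d ∙ z             ∎
    Trxy≈ : Tr G S (x ∙ y) ≈ (x ∙ y) ^ d ∙ (z ∙ (φx ∙ φy))
    Trxy≈ = begin
      Tr G S (x ∙ y)                    ≈⟨ transfer-∙ T x y ⟩
      Tr G S x ∙ Tr G S y               ≈⟨ ∙-cong Trx≈ Try≈ ⟩
      (x ^ d ∙ φx) ∙ (y ^ d ∙ φy)       ≈⟨ assoc _ _ _ ⟨
      ((x ^ d ∙ φx) ∙ y ^ d) ∙ φy       ≈⟨ ∙-congʳ (central-slide cφx _ _) ⟩
      ((x ^ d ∙ y ^ d) ∙ φx) ∙ φy       ≈⟨ assoc _ _ _ ⟩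
      (x ^ d ∙ y ^ d) ∙ (φx ∙ φy)       ≈⟨ ∙-congʳ xᵈyᵈ≈ ⟩
      ((x ∙ y) ^ d ∙ z) ∙ (φx ∙ φy)     ≈⟨ assoc _ _ _ ⟩
      (x ∙ y) ^ d ∙ (z ∙ (φx ∙ φy))     ∎

  TrUpToCentralInvolution-pow : ∀ {x} n → TrUpToCentralInvolution x → TrUpToCentralInvolution (x ^ n)
  TrUpToCentralInvolution-pow zero    _  = TrUpToCentralInvolution-ε
  TrUpToCentralInvolution-pow (suc n) px = TrUpToCentralInvolution-∙ px (TrUpToCentralInvolution-pow n px)

  TrUpToCentralInvolution-∏ : ∀ n (f : Fin n → Carrier) → (∀ i → TrUpToCentralInvolution (f i)) →
                              TrUpToCentralInvolution (∏ n f)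
  TrUpToCentralInvolution-∏ zero    f pf = TrUpToCentralInvolution-ε
  TrUpToCentralInvolution-∏ (suc n) f pf =
    TrUpToCentralInvolution-∙ (pf Fin.zero) (TrUpToCentralInvolution-∏ n _ (pf ∘ Fin.suc))

  TrUpToCentralInvolution-∈H : ∀ {h} → H h → TrUpToCentralInvolution h
  TrUpToCentralInvolution-∈H h∈H = _ , transfer-∈H h∈H , comm-central _ _ , comm-∈H-square h∈H α²≡πε

  TrUpToCentralInvolution-ts : ∀ i → TrUpToCentralInvolution (ts i)
  TrUpToCentralInvolution-ts i =
    _ , A.transfer-ts , comm-central _ _ , comm-∈H-square (ts-pow-m-∈H i) A.αᵢ²≡πε
    where module A = AdaptedTransversal i (coordinate-kernel-complement i) (proj₂ (coordinate-kernel-transversal i))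

  part-iii : Part-iii G S
  part-iii g with (a , h , h∈H , g≈ah) ← decomposition g =
    TrUpToCentralInvolution-resp (sym g≈ah) (TrUpToCentralInvolution-∙
      (TrUpToCentralInvolution-∏ s _ (λ i → TrUpToCentralInvolution-pow (toℕ (a i)) (TrUpToCentralInvolution-ts i)))
      (TrUpToCentralInvolution-∈H h∈H))

  part-ii : Part-ii G S
  part-ii = (λ i _ K-complement _ R → AdaptedTransversal.part-ii-ts i K-complement R) , part-ii-H

lemma2p10 : ∀ {c ℓ p : Level} (G : Group c ℓ) (S : Setting G p) →
    Part-i G S × Part-ii G S × Part-iii G S × Moreover G S
lemma2p10 G S = part-i , part-ii , part-iii , moreover
  where open ClassTwoTransfer G S
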